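{- Let $G$ be a (theta, prism)-free graph, let $H$ be an induced subgraph of $G$, and let $a\in V(H)$ be trapped in $H$. Let $\Sigma$ be a pyramid in $H$ with apex $a$, base $b_1b_2b_3$ and paths $P_1,P_2,P_3$. Let $p\in V(G)\setminus V(H)$. Then $p$ is wide for $\Sigma$ if and only if $p$ is either a corner path for $\Sigma$ (the one-vertex path $p$) or a jewel for $\Sigma$.
   Context: All graphs are finite and simple; induced subgraphs are identified with their vertex sets; a "path in $G$" is an induced subgraph of $G$ that is a path; length of a path = number of edges; $P^*$ is the interior. For $X\subseteq V(G)$, $N_X(v)=N_G(v)\cap X$. Sets $X,Y$ are complete (anticomplete) if all (no) edges between them are present. Theta: two non-adjacent vertices with three internally disjoint paths between them of length at least two with pairwise anticomplete interiors. Prism: two disjoint triangles $\{a_1,a_2,a_3\},\{b_1,b_2,b_3\}$ and disjoint paths $P_i$ from $a_i$ to $b_i$ such that for $i\neq j$ the only edges between $P_i$ and $P_j$ are $a_ia_j,b_ib_j$. A pyramid is a graph $\Sigma$ consisting of a vertex $a$ (apex), a triangle $\{b_1,b_2,b_3\}$ (base) and three paths $P_1,P_2,P_3$ of length at least one, $P_i$ from $a$ to $b_i$, otherwise pairwise disjoint, such that for distinct $i,j$, $b_ib_j$ is the only edge between $P_i\setminus\{a\}$ and $P_j\setminus\{a\}$, and at most one of $P_1,P_2,P_3$ has length exactly one. A pyramid in $G$ is an induced subgraph that is a pyramid. A vertex $a$ of an induced subgraph $H$ of $G$ is trapped in $H$ if every vertex at distance at most two from $a$ in $G$ lies in $H$,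 and every vertex of $N_G(a)$ has degree two in $H$. A set $X\subseteq\Sigma$ is local in $\Sigma$ if $X\subseteq P_i$ for some $i$ or $X\subseteq\{b_1,b_2,b_3\}$. A vertex $p\notin\Sigma$ is narrow for $\Sigma$ if $N_\Sigma(p)$ is local in $\Sigma$, and wide otherwise. For a path $P$ in $G\setminus\Sigma$ with (not necessarily distinct) ends $p_1,p_2$, $P$ is a corner path for $\Sigma$ at $b_i$ if $p_1$ has a neighbor in $P_i\setminus\{b_i\}$, $p_2$ is complete to $\{b_1,b_2,b_3\}\setminus\{b_i\}$, and apart from these edges there is no edge between $P$ and $\Sigma\setminus\{b_i\}$; a corner path for $\Sigma$ is a corner path at some $b_i$. A vertex $p\notin\Sigma$ is a jewel for $\Sigma$ at $b_i$ if $p$ is anticomplete to $P_i$ and for every $j\neq i$, $N_{P_j}(p)=N_{P_j}[b_j]$ (i.e. $p$ is adjacent in $P_j$ exactly to $b_j$ and its neighbor on $P_j$); a jewel for $\Sigma$ is a jewel at some $b_i$. -}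

module Defs where

open import Data.Nat using (ℕ; zero; suc; _≤_; _<_)
open import Data.Bool using (Bool; true; false)
open import Data.Fin using (Fin; toℕ; fromℕ)
open import Data.Fin.Subset using (Subset; _∈_; _∩_; ∣_∣)
open import Data.Vec using (tabulate)
open import Data.Product using (Σ; ∃; _×_; _,_)
open import Data.Sum using (_⊎_)
open import Relation.Nullary using (¬_)
open import Relation.Binary.PropositionalEquality using (_≡_; _≢_)
open import Function.Bundles using (_⇔_)

record Graph : Set where
  field
    n      : ℕ
    adj    : Fin n → Fin n → Bool
    sym    : ∀ x y → adj x y ≡ adj y x
    irrefl : ∀ x → adj x x ≡ false

module _ (G : Graph) where
  open Graph G

  V : Set
  V = Fin n

  Edge : V → V → Set
  Edge x y = adj x y ≡ true

  Nbhd : V → Subset n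
  Nbhd u = tabulate (adj u)

  record Path : Set where
    field
      len : ℕ
      vtx : Fin (suc len) → V
      inj : ∀ i j → vtx i ≡ vtx j → i ≡ j
      ind : ∀ i j → Edge (vtx i) (vtx j) ⇔ (suc (toℕ i) ≡ toℕ j ⊎ suc (toℕ j) ≡ toℕ i)

    start : V
    start = vtx Fin.zero

    end : V
    end = vtx (fromℕ len)

  open Path public

  _∈P_ : V → Path → Set
  v ∈P P = ∃ λ i → vtx P i ≡ v

  _∈int_ : V → Path → Set
  v ∈int P = ∃ λ i → 0 < toℕ i × toℕ i < len P × vtx P i ≡ v

  IsTheta : V → V → (Fin 3 → Path) → Set
  IsTheta x y Q =
      x ≢ y × ¬ Edge x y
    × (∀ i → start (Q i) ≡ x × end (Q i) ≡ y × 2 ≤ len (Q i))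
    × (∀ i j → i ≢ j → ∀ v → v ∈int Q i → ¬ (v ∈P Q j))
    × (∀ i j → i ≢ j → ∀ u v → u ∈int Q i → v ∈int Q j → ¬ Edge u v)

  HasTheta : Set
  HasTheta = Σ V λ x → Σ V λ y → Σ (Fin 3 → Path) λ Q → IsTheta x y Q

  IsPrism : (Fin 3 → V) → (Fin 3 → V) → (Fin 3 → Path) → Set
  IsPrism a b P =
      (∀ i j → i ≢ j → Edge (a i) (a j) × Edge (b i) (b j))
    × (∀ i → start (P i) ≡ a i × end (P i) ≡ b i)
    × (∀ i j → i ≢ j → ∀ u v → u ∈P P i → v ∈P P j →
          u ≢ v × (Edge u v → (u ≡ a i × v ≡ a j) ⊎ (u ≡ b i × v ≡ b j)))
    × (∀ i j → a i ≢ b j)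

  HasPrism : Set
  HasPrism = Σ (Fin 3 → V) λ a → Σ (Fin 3 → V) λ b → Σ (Fin 3 → Path) λ P → IsPrism a b P

  IsPyramid : V → (Fin 3 → V) → (Fin 3 → Path) → Set
  IsPyramid a b P =
      (∀ i → start (P i) ≡ a × end (P i) ≡ b i × 1 ≤ len (P i))
    × (∀ i j → i ≢ j → Edge (b i) (b j))
    × (∀ i j → i ≢ j → ∀ v → v ∈P P i → v ∈P P j → v ≡ a)
    × (∀ i j → i ≢ j → ∀ u v → u ∈P P i → v ∈P P j → u ≢ a → v ≢ a →
          Edge u v → u ≡ b i × v ≡ b j)
    × (∀ i j → len (P i) ≡ 1 → len (P j) ≡ 1 → i ≡ j)

  DistLe2 : V → V → Set
  DistLe2 a v = a ≡ v ⊎ Edge a v ⊎ ∃ λ w → Edge a w × Edge w v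

  Trapped : Subset n → V → Set
  Trapped H a = (∀ v → DistLe2 a v → v ∈ H)
              × (∀ u → Edge a u → ∣ H ∩ Nbhd u ∣ ≡ 2)

  module _ (b : Fin 3 → V) (P : Fin 3 → Path) where

    _∈Σ_ : V → Set
    _∈Σ_ v = ∃ λ i → v ∈P P i

    Narrow : V → Set
    Narrow p = (∃ λ i → ∀ v → _∈Σ_ v → Edge p v → v ∈P P i)
             ⊎ (∀ v → _∈Σ_ v → Edge p v → ∃ λ j → v ≡ b j)

    Wide : V → Set
    Wide p = ¬ Narrow p

    -- the one-vertex path p is a corner path for Σ at b i
    CornerVertexAt : Fin 3 → V → Set
    CornerVertexAt i p =
        (∃ λ v → v ∈P P i × v ≢ b i × Edge p v)
      × (∀ j → j ≢ i → Edge p (b j))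
      × (∀ v → _∈Σ_ v → v ≢ b i → Edge p v →
           (v ∈P P i × v ≢ b i) ⊎ (∃ λ j → j ≢ i × v ≡ b j))

    CornerVertex : V → Set
    CornerVertex p = ∃ λ i → CornerVertexAt i p

    JewelAt : Fin 3 → V → Set
    JewelAt i p =
        (∀ v → v ∈P P i → ¬ Edge p v)
      × (∀ j → j ≢ i → ∀ v → v ∈P P j → (Edge p v ⇔ (v ≡ b j ⊎ Edge v (b j))))

    Jewel : V → Set
    Jewel p = ∃ λ i → JewelAt i p

-- Since p is adjacent neither to a nor to a neighbour of a, its neighbours on each path P_i,
-- if any, lie between a top neighbour t_i ≥ 2 and a bottom neighbour s_i.  If p sees all three
-- paths and at most one of them only at its base, the paths a-P_i-t_i-p form a theta.  If p sees
-- exactly two paths P_i, P_j, then a unique neighbour y on P_j gives a theta with ends a and y,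
-- non-consecutive neighbours on P_i give a theta whose third branch runs through b_k b_i, and two
-- consecutive neighbours away from b_i give a prism with the base triangle; what survives is a
-- jewel at b_k.  If p sees all three paths, two of them only at their bases, it is a corner.
-- Conversely, corners and jewels see two base vertices and a non-base vertex, so they are wide.

module Submission where

open import Defs
open import Data.Fin using (Fin)
open import Data.Fin.Subset using (Subset; _∈_; _∉_)
open import Data.Product using (_×_)
open import Data.Sum using (_⊎_)
open import Relation.Nullary using (¬_)
open import Function.Bundles using (_⇔_)

open import Data.Bool using (true)
import Data.Bool.Properties as Bool
open import Data.Empty using (⊥; ⊥-elim)
open import Data.Fin as Fin using (toℕ; fromℕ)
open import Data.List using (List; []; _∷_; _++_; length; lookup)
open import Data.List.Membership.Propositional using () renaming (_∈_ to _∈ₗ_)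
open import Data.List.Membership.Propositional.Properties using (∈-lookup; ∈-++⁺ˡ; ∈-++⁺ʳ; ∈-++⁻)
open import Data.List.Relation.Binary.Disjoint.Propositional using (Disjoint)
import Data.List.Relation.Binary.Disjoint.Propositional.Properties as Disjoint
open import Data.List.Relation.Unary.All as All using (All; []; _∷_)
open import Data.List.Relation.Unary.All.Properties using (++⁺)
open import Data.List.Relation.Unary.Any using (here; there)
open import Data.List.Properties using (length-++-sucʳ; length-++-≤ˡ; length-++-≤ʳ; ++-assoc; ++-identityʳ)
open import Data.Nat using (ℕ; zero; suc; _+_; _∸_; _≤_; _<_; z≤n; s≤s)
open import Data.Nat.Properties using (suc-injective; m≤n⇒m<n∨m≡n; ≮⇒≥; ≤-antisym; ≤-refl; ≤-trans; ≤-pred; n≤1+n; m≤n⇒m≤1+n; m≤m+n; m+[n∸m]≡n; m≤n⇒∃[o]m+o≡n; m<n⇒0<n∸m; ≤-reflexive; <⇒≤; <⇒≢; <-irrefl; +-suc; +-identityʳ)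
open import Data.Fin.Properties using (toℕ≤pred[n])
open import Data.Product using (Σ; ∃; _,_; proj₁; proj₂; swap)
open import Data.Sum using (inj₁; inj₂; [_,_]) renaming (map to ⊎-map)
open import Data.Unit using (⊤; tt)
open import Function using (_∘_)
open import Function.Bundles using (mk⇔; Equivalence)
open import Relation.Nullary using (Dec; yes; no; contradiction)
open import Relation.Binary.PropositionalEquality hiding ([_])

pattern 0F = Fin.zero
pattern 1F = Fin.suc Fin.zero
pattern 2F = Fin.suc (Fin.suc Fin.zero)

triple : ∀ {A : Set} → A → A → A → Fin 3 → A
triple u v w 0F = u
triple u v w 1F = v
triple u v w 2F = w

pairwise-from-three : ∀ {R : Fin 3 → Fin 3 → Set} → (∀ {i j} → R i j → R j i) →
                      R 0F 1F → R 0F 2F → R 1F 2F → ∀ i j → i ≢ j → R i j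
pairwise-from-three R-sym r₀₁ r₀₂ r₁₂ 0F 1F _ = r₀₁
pairwise-from-three R-sym r₀₁ r₀₂ r₁₂ 0F 2F _ = r₀₂
pairwise-from-three R-sym r₀₁ r₀₂ r₁₂ 1F 2F _ = r₁₂
pairwise-from-three R-sym r₀₁ r₀₂ r₁₂ 1F 0F _ = R-sym r₀₁
pairwise-from-three R-sym r₀₁ r₀₂ r₁₂ 2F 0F _ = R-sym r₀₂
pairwise-from-three R-sym r₀₁ r₀₂ r₁₂ 2F 1F _ = R-sym r₁₂
pairwise-from-three R-sym r₀₁ r₀₂ r₁₂ 0F 0F i≢i = contradiction refl i≢i
pairwise-from-three R-sym r₀₁ r₀₂ r₁₂ 1F 1F i≢i = contradiction refl i≢i
pairwise-from-three R-sym r₀₁ r₀₂ r₁₂ 2F 2F i≢i = contradiction refl i≢i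

record Others (k : Fin 3) : Set where
  field
    i j   : Fin 3
    i≢j   : i ≢ j
    i≢k   : i ≢ k
    j≢k   : j ≢ k
    cover : ∀ l → l ≡ i ⊎ l ≡ j ⊎ l ≡ k

  by-cover : ∀ {Q : Fin 3 → Set} → Q i → Q j → Q k → ∀ l → Q l
  by-cover qi qj qk l with cover l
  ... | inj₁ refl        = qi
  ... | inj₂ (inj₁ refl) = qj
  ... | inj₂ (inj₂ refl) = qk

others : ∀ k → Others k
others 0F = record { i = 1F ; j = 2F ; i≢j = λ () ; i≢k = λ () ; j≢k = λ ()
                   ; cover = λ { 0F → inj₂ (inj₂ refl) ; 1F → inj₁ refl ; 2F → inj₂ (inj₁ refl) } }
others 1F = record { i = 0F ; j = 2F ; i≢j = λ () ; i≢k = λ () ; j≢k = λ ()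
                   ; cover = λ { 0F → inj₁ refl ; 1F → inj₂ (inj₂ refl) ; 2F → inj₂ (inj₁ refl) } }
others 2F = record { i = 0F ; j = 1F ; i≢j = λ () ; i≢k = λ () ; j≢k = λ ()
                   ; cover = λ { 0F → inj₁ refl ; 1F → inj₂ (inj₁ refl) ; 2F → inj₂ (inj₂ refl) } }

swapped : ∀ {k} → Others k → Others k
swapped O = record { i = j ; j = i ; i≢j = i≢j ∘ sym ; i≢k = j≢k ; j≢k = i≢k
                ; cover = λ l → [ inj₂ ∘ inj₁ , [ inj₁ , inj₂ ∘ inj₂ ] ] (cover l) }
  where open Others O

pairwise-or-two : ∀ {A B : Fin 3 → Set} → (∀ m → A m ⊎ B m) →
                  (∀ m m′ → m ≢ m′ → A m ⊎ A m′) ⊎ ∃ λ k → Σ (Others k) λ O → B (Others.i O) × B (Others.j O)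
pairwise-or-two {A} {B} A⊎B with pair 0F 1F | pair 0F 2F | pair 1F 2F
  where
    pair : ∀ m m′ → (A m ⊎ A m′) ⊎ (B m × B m′)
    pair m m′ with A⊎B m | A⊎B m′
    ... | inj₁ a | _      = inj₁ (inj₁ a)
    ... | inj₂ _ | inj₁ a = inj₁ (inj₂ a)
    ... | inj₂ b | inj₂ b′ = inj₂ (b , b′)
... | inj₂ bb | _      | _      = inj₂ (2F , others 2F , bb)
... | inj₁ _  | inj₂ bb | _      = inj₂ (1F , others 1F , bb)
... | inj₁ _  | inj₁ _  | inj₂ bb = inj₂ (0F , others 0F , bb)
... | inj₁ a₀₁ | inj₁ a₀₂ | inj₁ a₁₂ =
  inj₁ (pairwise-from-three (λ {m} {m′} → [ inj₂ , inj₁ ]) a₀₁ a₀₂ a₁₂)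

module InducedLists (G : Graph) where

  infix 4 _~_

  _~_ : V G → V G → Set
  _~_ = Edge G

  ~-sym : ∀ {x y} → x ~ y → y ~ x
  ~-sym {x} {y} = trans (Graph.sym G y x)

  ~-irrefl : ∀ {x} → ¬ x ~ x
  ~-irrefl {x} e = contradiction (trans (sym e) (Graph.irrefl G x)) λ ()

  ~⇒≢ : ∀ {x y} → x ~ y → x ≢ y
  ~⇒≢ e refl = ~-irrefl e

  _~?_ : ∀ x y → Dec (x ~ y)
  x ~? y = Graph.adj G x y Bool.≟ true

  Apart : V G → V G → Set
  Apart x y = x ≢ y × ¬ x ~ y

  Apart-sym : ∀ {x y} → Apart x y → Apart y x
  Apart-sym (x≢y , x≁y) = x≢y ∘ sym , x≁y ∘ ~-sym

  Anticomplete : List (V G) → List (V G) → Set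
  Anticomplete xs ys = ∀ {u v} → u ∈ₗ xs → v ∈ₗ ys → ¬ u ~ v

  Anticomplete-sym : ∀ {xs ys} → Anticomplete xs ys → Anticomplete ys xs
  Anticomplete-sym xs≁ys v∈ys u∈xs = xs≁ys u∈xs v∈ys ∘ ~-sym

  Attached : V G → List (V G) → Set
  Attached x []       = ⊤
  Attached x (y ∷ zs) = x ~ y × x ≢ y × All (Apart x) zs

  Induced : List (V G) → Set
  Induced []       = ⊤
  Induced (x ∷ xs) = Attached x xs × Induced xs

  Joinable : List (V G) → List (V G) → Set
  Joinable []            ys = ⊤
  Joinable (x ∷ [])      ys = Attached x ys
  Joinable (x ∷ x′ ∷ xs) ys = All (Apart x) ys × Joinable (x′ ∷ xs) ys

  ++-induced : ∀ xs ys → Induced xs → Induced ys → Joinable xs ys → Induced (xs ++ ys)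
  ++-induced []            ys _                  ys-ind _          = ys-ind
  ++-induced (x ∷ [])      ys _                  ys-ind x-att      = x-att , ys-ind
  ++-induced (x ∷ x′ ∷ xs) ys ((e , ne , A) , I) ys-ind (x-ys , J) =
    (e , ne , ++⁺ A x-ys) , ++-induced (x′ ∷ xs) ys I ys-ind J

  attached-++ : ∀ {x} xs ys → 1 ≤ length xs → Attached x xs → All (Apart x) ys → Attached x (xs ++ ys)
  attached-++ (y ∷ zs) ys _ (e , ne , A) x-ys = e , ne , ++⁺ A x-ys

  attached-∉ : ∀ {x} ys → Attached x ys → ¬ x ∈ₗ ys
  attached-∉ (y ∷ zs) (_ , x≢y , _) (here x≡y) = x≢y x≡y
  attached-∉ (y ∷ zs) (_ , _ , A)   (there h)  = proj₁ (All.lookup A h) refl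

  induced-++-disjoint : ∀ xs ys → Induced (xs ++ ys) → Disjoint xs ys
  induced-++-disjoint (x ∷ xs) ys (att , _) (here refl , v∈ys) = attached-∉ (xs ++ ys) att (∈-++⁺ʳ xs v∈ys)
  induced-++-disjoint (x ∷ xs) ys (_ , I)   (there h , v∈ys)   = induced-++-disjoint xs ys I (h , v∈ys)

  private
    attached-≢ : ∀ {x} ys → Attached x ys → ∀ j → x ≢ lookup ys j
    attached-≢ ys att j refl = attached-∉ ys att (∈-lookup j)

    attached-~⇒zero : ∀ {x} ys → Attached x ys → ∀ j → x ~ lookup ys j → toℕ j ≡ 0
    attached-~⇒zero (y ∷ zs) _           Fin.zero    _ = refl
    attached-~⇒zero (y ∷ zs) (_ , _ , A) (Fin.suc j) e = contradiction e (proj₂ (All.lookup A (∈-lookup j)))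

    attached-~-head : ∀ {x} ys → Attached x ys → ∀ j → toℕ j ≡ 0 → x ~ lookup ys j
    attached-~-head (y ∷ zs) (e , _) Fin.zero _ = e

    induced-lookup-injective : ∀ x xs → Induced (x ∷ xs) → ∀ i j →
                               lookup (x ∷ xs) i ≡ lookup (x ∷ xs) j → i ≡ j
    induced-lookup-injective x xs       _         Fin.zero    Fin.zero    _  = refl
    induced-lookup-injective x xs       (att , _) Fin.zero    (Fin.suc j) eq = contradiction eq (attached-≢ xs att j)
    induced-lookup-injective x xs       (att , _) (Fin.suc i) Fin.zero    eq = contradiction (sym eq) (attached-≢ xs att i)
    induced-lookup-injective x (y ∷ zs) (_ , I)   (Fin.suc i) (Fin.suc j) eq =
      cong Fin.suc (induced-lookup-injective y zs I i j eq)

    induced-lookup-~ : ∀ x xs → Induced (x ∷ xs) → ∀ i j →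
                       lookup (x ∷ xs) i ~ lookup (x ∷ xs) j ⇔ (suc (toℕ i) ≡ toℕ j ⊎ suc (toℕ j) ≡ toℕ i)
    induced-lookup-~ x xs _ Fin.zero Fin.zero =
      mk⇔ (⊥-elim ∘ ~-irrefl) (λ { (inj₁ ()) ; (inj₂ ()) })
    induced-lookup-~ x xs (att , _) Fin.zero (Fin.suc j) =
      mk⇔ (λ e → inj₁ (cong suc (sym (attached-~⇒zero xs att j e))))
          (λ { (inj₁ eq) → attached-~-head xs att j (sym (suc-injective eq)) ; (inj₂ ()) })
    induced-lookup-~ x xs (att , _) (Fin.suc i) Fin.zero =
      mk⇔ (λ e → inj₂ (cong suc (sym (attached-~⇒zero xs att i (~-sym e)))))
          (λ { (inj₂ eq) → ~-sym (attached-~-head xs att i (sym (suc-injective eq))) ; (inj₁ ()) })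
    induced-lookup-~ x (y ∷ zs) (_ , I) (Fin.suc i) (Fin.suc j) =
      mk⇔ (⊎-map (cong suc) (cong suc) ∘ to) (from ∘ ⊎-map suc-injective suc-injective)
      where open Equivalence (induced-lookup-~ y zs I i j)

  toPath : ∀ x xs → Induced (x ∷ xs) → Path G
  toPath x xs I = record
    { len = length xs
    ; vtx = lookup (x ∷ xs)
    ; inj = induced-lookup-injective x xs I
    ; ind = induced-lookup-~ x xs I
    }

  lastOf : V G → List (V G) → V G
  lastOf x []       = x
  lastOf x (y ∷ ys) = lastOf y ys

  lastOf-∈ : ∀ x xs → lastOf x xs ∈ₗ x ∷ xs
  lastOf-∈ x []       = here refl
  lastOf-∈ x (y ∷ ys) = there (lastOf-∈ y ys)

  lastOf-++ : ∀ x xs y ys → lastOf x (xs ++ y ∷ ys) ≡ lastOf y ys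
  lastOf-++ x []       y ys = refl
  lastOf-++ x (z ∷ xs) y ys = lastOf-++ z xs y ys

  toPath-end : ∀ x xs I → end (toPath x xs I) ≡ lastOf x xs
  toPath-end x []       I       = refl
  toPath-end x (y ∷ ys) (_ , I) = toPath-end y ys I

  toPath-∈ : ∀ {x xs I v} → _∈P_ G v (toPath x xs I) → v ∈ₗ x ∷ xs
  toPath-∈ (i , refl) = ∈-lookup i

  record Branch (x y : V G) : Set where
    field
      interior : List (V G)
      nonempty : 1 ≤ length interior
      induced  : Induced (x ∷ interior ++ y ∷ [])

    path : Path G
    path = toPath x (interior ++ y ∷ []) induced

    ends-apart : Apart x y
    ends-apart = go interior nonempty induced
      where
        go : ∀ mid → 1 ≤ length mid → Induced (x ∷ mid ++ y ∷ []) → Apart x y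
        go (_ ∷ mid) _ ((_ , _ , A) , _) = All.lookup A (∈-++⁺ʳ mid (here refl))

    interior-avoids-ends : ∀ {v} → v ∈ₗ interior → v ≢ x × v ≢ y
    interior-avoids-ends v∈ =
      (λ { refl → attached-∉ (interior ++ y ∷ []) (proj₁ induced) (∈-++⁺ˡ v∈) }) ,
      (λ { refl → induced-++-disjoint interior (y ∷ []) (proj₂ induced) (v∈ , here refl) })

    path-∈ : ∀ {v} → _∈P_ G v path → v ≡ x ⊎ v ∈ₗ interior ⊎ v ≡ y
    path-∈ v∈ with toPath-∈ {I = induced} v∈
    ... | here v≡x = inj₁ v≡x
    ... | there h with ∈-++⁻ interior h
    ...   | inj₁ v∈int     = inj₂ (inj₁ v∈int)
    ...   | inj₂ (here v≡y) = inj₂ (inj₂ v≡y)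

    path-∈int : ∀ {v} → _∈int_ G v path → v ∈ₗ interior
    path-∈int (i , 0<i , i<len , refl) = go x interior i 0<i i<len
      where
        go : ∀ x mid (i : Fin (suc (length (mid ++ y ∷ [])))) → 0 < toℕ i → toℕ i < length (mid ++ y ∷ []) →
             lookup (x ∷ mid ++ y ∷ []) i ∈ₗ mid
        go x []        (Fin.suc Fin.zero)    _ (s≤s ())
        go x (m ∷ mid) (Fin.suc Fin.zero)    _ _           = here refl
        go x (m ∷ mid) (Fin.suc (Fin.suc i)) _ (s≤s i<len) = there (go m mid (Fin.suc i) (s≤s z≤n) i<len)

    path-end : end path ≡ y
    path-end = trans (toPath-end x (interior ++ y ∷ []) induced) (lastOf-++ x interior y [])

    path-len : 2 ≤ len path
    path-len = go interior nonempty
      where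
        go : ∀ mid → 1 ≤ length mid → 2 ≤ length (mid ++ y ∷ [])
        go (_ ∷ mid) _ rewrite length-++-sucʳ mid y [] = s≤s (s≤s z≤n)

  open Branch public using (interior)

  theta-from-branches : ∀ {x y} (B₀ B₁ B₂ : Branch x y) →
    Disjoint (interior B₀) (interior B₁) → Disjoint (interior B₀) (interior B₂) →
    Disjoint (interior B₁) (interior B₂) →
    Anticomplete (interior B₀) (interior B₁) → Anticomplete (interior B₀) (interior B₂) →
    Anticomplete (interior B₁) (interior B₂) → HasTheta G
  theta-from-branches {x} {y} B₀ B₁ B₂ d₀₁ d₀₂ d₁₂ a₀₁ a₀₂ a₁₂ =
    x , y , path ∘ B , proj₁ (ends-apart B₀) , proj₂ (ends-apart B₀) ,
    (λ α → refl , path-end (B α) , path-len (B α)) , disjoint , anticomplete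
    where
      open Branch

      B : Fin 3 → Branch x y
      B = triple B₀ B₁ B₂

      D : ∀ α β → α ≢ β → Disjoint (interior (B α)) (interior (B β))
      D = pairwise-from-three Disjoint.sym d₀₁ d₀₂ d₁₂

      A : ∀ α β → α ≢ β → Anticomplete (interior (B α)) (interior (B β))
      A = pairwise-from-three Anticomplete-sym a₀₁ a₀₂ a₁₂

      disjoint : ∀ α β → α ≢ β → ∀ v → _∈int_ G v (path (B α)) → ¬ _∈P_ G v (path (B β))
      disjoint α β α≢β v v∈α v∈β with path-∈int (B α) v∈α | path-∈ (B β) v∈β
      ... | h | inj₁ v≡x        = proj₁ (interior-avoids-ends (B α) h) v≡x
      ... | h | inj₂ (inj₁ h′)  = D α β α≢β (h , h′)
      ... | h | inj₂ (inj₂ v≡y) = proj₂ (interior-avoids-ends (B α) h) v≡y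

      anticomplete : ∀ α β → α ≢ β → ∀ u v → _∈int_ G u (path (B α)) → _∈int_ G v (path (B β)) → ¬ u ~ v
      anticomplete α β α≢β u v u∈ v∈ = A α β α≢β (path-∈int (B α) u∈) (path-∈int (B β) v∈)

  record Rail : Set where
    field
      first    : V G
      rest     : List (V G)
      nonempty : 1 ≤ length rest
      induced  : Induced (first ∷ rest)

    final : V G
    final = lastOf first rest

    path : Path G
    path = toPath first rest induced

    path-end : end path ≡ final
    path-end = toPath-end first rest induced

    first≢final : first ≢ final
    first≢final = go rest nonempty (proj₁ induced)
      where
        go : ∀ ys → 1 ≤ length ys → Attached first ys → first ≢ lastOf first ys
        go (y ∷ ys) _ att eq = attached-∉ (y ∷ ys) att (subst (_∈ₗ y ∷ ys) (sym eq) (lastOf-∈ y ys))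

  open Rail public using (first; rest; final)

  Linked : Rail → Rail → Set
  Linked R R′ = ∀ {u v} → u ∈ₗ first R ∷ rest R → v ∈ₗ first R′ ∷ rest R′ →
                u ≢ v × (u ~ v → (u ≡ first R × v ≡ first R′) ⊎ (u ≡ final R × v ≡ final R′))

  Linked-sym : ∀ {R R′} → Linked R R′ → Linked R′ R
  Linked-sym L v∈ u∈ = proj₁ (L u∈ v∈) ∘ sym , ⊎-map swap swap ∘ proj₂ (L u∈ v∈) ∘ ~-sym

  prism-from-rails : (R₀ R₁ R₂ : Rail) →
    first R₀ ~ first R₁ → first R₀ ~ first R₂ → first R₁ ~ first R₂ →
    final R₀ ~ final R₁ → final R₀ ~ final R₂ → final R₁ ~ final R₂ →
    Linked R₀ R₁ → Linked R₀ R₂ → Linked R₁ R₂ → HasPrism G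
  prism-from-rails R₀ R₁ R₂ f₀₁ f₀₂ f₁₂ l₀₁ l₀₂ l₁₂ L₀₁ L₀₂ L₁₂ =
    first ∘ R , final ∘ R , path ∘ R , triangles , (λ α → refl , path-end (R α)) , linked , firsts≢finals
    where
      open Rail

      R : Fin 3 → Rail
      R = triple R₀ R₁ R₂

      triangles : ∀ α β → α ≢ β → first (R α) ~ first (R β) × final (R α) ~ final (R β)
      triangles = pairwise-from-three {λ α β → first (R α) ~ first (R β) × final (R α) ~ final (R β)}
                    (λ (e , e′) → ~-sym e , ~-sym e′) (f₀₁ , l₀₁) (f₀₂ , l₀₂) (f₁₂ , l₁₂)

      L : ∀ α β → α ≢ β → Linked (R α) (R β)
      L = pairwise-from-three (λ {α} {β} → Linked-sym {R α} {R β}) L₀₁ L₀₂ L₁₂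

      linked : ∀ α β → α ≢ β → ∀ u v → _∈P_ G u (path (R α)) → _∈P_ G v (path (R β)) →
               u ≢ v × (u ~ v → (u ≡ first (R α) × v ≡ first (R β)) ⊎ (u ≡ final (R α) × v ≡ final (R β)))
      linked α β α≢β u v u∈ v∈ = L α β α≢β (toPath-∈ {I = induced (R α)} u∈) (toPath-∈ {I = induced (R β)} v∈)

      firsts≢finals : ∀ α β → first (R α) ≢ final (R β)
      firsts≢finals α β with α Fin.≟ β
      ... | yes refl = first≢final (R α)
      ... | no α≢β   = proj₁ (L α β α≢β (here refl) (lastOf-∈ (first (R β)) (rest (R β))))

clamp : (L k : ℕ) → Fin (suc L)
clamp L       zero    = Fin.zero
clamp zero    (suc k) = Fin.zero
clamp (suc L) (suc k) = Fin.suc (clamp L k)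

toℕ-clamp : ∀ L k → k ≤ L → toℕ (clamp L k) ≡ k
toℕ-clamp L       zero    _         = refl
toℕ-clamp (suc L) (suc k) (s≤s k≤L) = cong suc (toℕ-clamp L k k≤L)

clamp-toℕ : ∀ L (i : Fin (suc L)) → clamp L (toℕ i) ≡ i
clamp-toℕ L       Fin.zero    = refl
clamp-toℕ (suc L) (Fin.suc i) = cong Fin.suc (clamp-toℕ L i)

clamp-self : ∀ L → clamp L L ≡ fromℕ L
clamp-self zero    = refl
clamp-self (suc L) = cong Fin.suc (clamp-self L)

least-witness : ∀ {Q : ℕ → Set} → (∀ n → Dec (Q n)) → ∀ L →
                (∀ n → n ≤ L → ¬ Q n) ⊎ (∃ λ t → t ≤ L × Q t × (∀ n → n < t → ¬ Q n))
least-witness Q? zero with Q? 0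
... | yes q  = inj₂ (0 , z≤n , q , λ _ ())
... | no ¬q  = inj₁ λ { zero _ → ¬q }
least-witness Q? (suc L) with least-witness Q? L
... | inj₂ (t , t≤L , q , least) = inj₂ (t , m≤n⇒m≤1+n t≤L , q , least)
... | inj₁ none with Q? (suc L)
...   | yes q = inj₂ (suc L , ≤-refl , q , λ n n≤L → none n (≤-pred n≤L))
...   | no ¬q = inj₁ λ n n≤1+L → [ none n ∘ ≤-pred , (λ { refl → ¬q }) ] (m≤n⇒m<n∨m≡n n≤1+L)

greatest-witness : ∀ {Q : ℕ → Set} → (∀ n → Dec (Q n)) → ∀ L →
                   (∀ n → n ≤ L → ¬ Q n) ⊎ (∃ λ s → s ≤ L × Q s × (∀ n → s < n → n ≤ L → ¬ Q n))
greatest-witness Q? L with Q? L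
... | yes q = inj₂ (L , ≤-refl , q , λ n L<n n≤L → ⊥-elim (<-irrefl refl (≤-trans L<n n≤L)))
greatest-witness Q? zero    | no ¬q = inj₁ λ { zero _ → ¬q }
greatest-witness Q? (suc L) | no ¬q with greatest-witness Q? L
... | inj₂ (s , s≤L , q , greatest) =
  inj₂ (s , m≤n⇒m≤1+n s≤L , q ,
        λ n s<n n≤1+L → [ greatest n s<n ∘ ≤-pred , (λ { refl → ¬q }) ] (m≤n⇒m<n∨m≡n n≤1+L))
... | inj₁ none = inj₁ λ n n≤1+L → [ none n ∘ ≤-pred , (λ { refl → ¬q }) ] (m≤n⇒m<n∨m≡n n≤1+L)

module PyramidCoordinates (G : Graph) {a : V G} {b : Fin 3 → V G} {P : Fin 3 → Path G}
                          (pyramid : IsPyramid G a b P) where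
  open InducedLists G

  L : Fin 3 → ℕ
  L m = len (P m)

  -- Vertex n of P m, counting from the apex; indices beyond L m give junk.
  vertex : Fin 3 → ℕ → V G
  vertex m n = vtx (P m) (clamp (L m) n)

  private
    ends  = proj₁ pyramid
    base  = proj₁ (proj₂ pyramid)
    meet  = proj₁ (proj₂ (proj₂ pyramid))
    cross = proj₁ (proj₂ (proj₂ (proj₂ pyramid)))

  vertex-injective : ∀ {m n n′} → n ≤ L m → n′ ≤ L m → vertex m n ≡ vertex m n′ → n ≡ n′
  vertex-injective {m} {n} {n′} n≤L n′≤L eq = begin
    n                          ≡⟨ toℕ-clamp _ n n≤L ⟨
    toℕ (clamp (L m) n)         ≡⟨ cong toℕ (inj (P m) _ _ eq) ⟩
    toℕ (clamp (L m) n′)        ≡⟨ toℕ-clamp _ n′ n′≤L ⟩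
    n′                         ∎
    where open ≡-Reasoning

  vertex-~⇒consecutive : ∀ {m n n′} → n ≤ L m → n′ ≤ L m → vertex m n ~ vertex m n′ →
                         suc n ≡ n′ ⊎ suc n′ ≡ n
  vertex-~⇒consecutive {m} {n} {n′} n≤L n′≤L e =
    subst₂ (λ k k′ → suc k ≡ k′ ⊎ suc k′ ≡ k) (toℕ-clamp _ n n≤L) (toℕ-clamp _ n′ n′≤L)
           (Equivalence.to (ind (P m) _ _) e)

  vertex-~-suc : ∀ {m n} → suc n ≤ L m → vertex m n ~ vertex m (suc n)
  vertex-~-suc {m} {n} n<L = Equivalence.from (ind (P m) _ _) (inj₁ (begin
    suc (toℕ (clamp (L m) n))    ≡⟨ cong suc (toℕ-clamp _ n (≤-trans (n≤1+n n) n<L)) ⟩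
    suc n                        ≡⟨ toℕ-clamp _ (suc n) n<L ⟨
    toℕ (clamp (L m) (suc n))    ∎))
    where open ≡-Reasoning

  vertex-∈ : ∀ m n → _∈P_ G (vertex m n) (P m)
  vertex-∈ m n = clamp (L m) n , refl

  ∈⇒vertex : ∀ {m v} → _∈P_ G v (P m) → ∃ λ n → n ≤ L m × vertex m n ≡ v
  ∈⇒vertex {m} (i , refl) = toℕ i , toℕ≤pred[n] i , cong (vtx (P m)) (clamp-toℕ _ i)

  vertex-apex : ∀ m → vertex m 0 ≡ a
  vertex-apex m = proj₁ (ends m)

  vertex-base : ∀ m → vertex m (L m) ≡ b m
  vertex-base m = trans (cong (vtx (P m)) (clamp-self (L m))) (proj₁ (proj₂ (ends m)))

  1≤L : ∀ m → 1 ≤ L m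
  1≤L m = proj₂ (proj₂ (ends m))

  vertex≢apex : ∀ {m n} → 1 ≤ n → n ≤ L m → vertex m n ≢ a
  vertex≢apex {m} 1≤n n≤L eq = <⇒≢ 1≤n (sym (vertex-injective n≤L z≤n (trans eq (sym (vertex-apex m)))))

  shared-vertex-is-apex : ∀ {m m′ n n′} → m ≢ m′ → n ≤ L m → vertex m n ≡ vertex m′ n′ → n ≡ 0
  shared-vertex-is-apex {m} {m′} {n} {n′} m≢m′ n≤L eq = vertex-injective n≤L z≤n (begin
    vertex m n  ≡⟨ meet m m′ m≢m′ _ (vertex-∈ m n) (subst (λ v → _∈P_ G v (P m′)) (sym eq) (vertex-∈ m′ n′)) ⟩
    a           ≡⟨ vertex-apex m ⟨
    vertex m 0  ∎)
    where open ≡-Reasoning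

  cross-edge⇒bases : ∀ {m m′ n n′} → m ≢ m′ → 1 ≤ n → 1 ≤ n′ → n ≤ L m → n′ ≤ L m′ →
                     vertex m n ~ vertex m′ n′ → n ≡ L m × n′ ≡ L m′
  cross-edge⇒bases {m} {m′} {n} {n′} m≢m′ 1≤n 1≤n′ n≤L n′≤L e =
    vertex-injective n≤L ≤-refl (trans vn≡b (sym (vertex-base m))) ,
    vertex-injective n′≤L ≤-refl (trans vn′≡b (sym (vertex-base m′)))
    where
      bases = cross m m′ m≢m′ _ _ (vertex-∈ m n) (vertex-∈ m′ n′)
                    (vertex≢apex 1≤n n≤L) (vertex≢apex 1≤n′ n′≤L) e
      vn≡b  = proj₁ bases
      vn′≡b = proj₂ bases

  base-edge : ∀ {m m′} → m ≢ m′ → b m ~ b m′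
  base-edge = base _ _

  base-~ : ∀ {m m′ n n′} → m ≢ m′ → n ≡ L m → n′ ≡ L m′ → vertex m n ~ vertex m′ n′
  base-~ {m} {m′} m≢m′ refl refl = subst₂ _~_ (sym (vertex-base m)) (sym (vertex-base m′)) (base m m′ m≢m′)

  apex-~-vertex₁ : ∀ m → a ~ vertex m 1
  apex-~-vertex₁ m = subst (_~ vertex m 1) (vertex-apex m) (vertex-~-suc (1≤L m))

  apex-~⇒index₁ : ∀ {m n} → n ≤ L m → a ~ vertex m n → n ≡ 1
  apex-~⇒index₁ {m} {n} n≤L e
    with vertex-~⇒consecutive z≤n n≤L (subst (_~ vertex m n) (sym (vertex-apex m)) e)
  ... | inj₁ 1≡n = sym 1≡n

  InSegment : Fin 3 → ℕ → ℕ → V G → Set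
  InSegment m lo hi x = ∃ λ n → lo ≤ n × n < hi × n ≤ L m × vertex m n ≡ x

  vertex-in-segment : ∀ {m n} → n ≤ L m → InSegment m n (suc n) (vertex m n)
  vertex-in-segment n≤L = _ , ≤-refl , ≤-refl , n≤L , refl

  segments-disjoint : ∀ {m m′ lo hi lo′ hi′ x y} → m ≢ m′ → 1 ≤ lo →
                      InSegment m lo hi x → InSegment m′ lo′ hi′ y → x ≢ y
  segments-disjoint m≢m′ 1≤lo (n , lo≤n , _ , n≤L , refl) (_ , _ , _ , _ , refl) eq =
    <⇒≢ (≤-trans 1≤lo lo≤n) (sym (shared-vertex-is-apex m≢m′ n≤L eq))

  segments-disjoint-ordered : ∀ {m lo hi lo′ hi′ x y} → hi ≤ lo′ →
                              InSegment m lo hi x → InSegment m lo′ hi′ y → x ≢ y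
  segments-disjoint-ordered hi≤lo′ (n , _ , n<hi , n≤L , refl) (n′ , lo′≤n′ , _ , n′≤L , refl) eq =
    <⇒≢ (≤-trans n<hi (≤-trans hi≤lo′ lo′≤n′)) (vertex-injective n≤L n′≤L eq)

  segment-avoids-apex : ∀ {m lo hi x} → 1 ≤ lo → InSegment m lo hi x → x ≢ a
  segment-avoids-apex 1≤lo (_ , lo≤n , _ , n≤L , refl) = vertex≢apex (≤-trans 1≤lo lo≤n) n≤L

  apex-anticomplete-segment : ∀ {m lo hi y} → 2 ≤ lo → InSegment m lo hi y → ¬ a ~ y
  apex-anticomplete-segment 2≤lo (_ , lo≤n , _ , n≤L , refl) e =
    <⇒≢ (≤-trans 2≤lo lo≤n) (sym (apex-~⇒index₁ n≤L e))

  segments-anticomplete : ∀ {m m′ lo hi lo′ hi′ x y} → m ≢ m′ → 1 ≤ lo → 1 ≤ lo′ →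
                          hi ≤ L m ⊎ hi′ ≤ L m′ →
                          InSegment m lo hi x → InSegment m′ lo′ hi′ y → ¬ x ~ y
  segments-anticomplete m≢m′ 1≤lo 1≤lo′ short
    (n , lo≤n , n<hi , n≤L , refl) (n′ , lo′≤n′ , n′<hi′ , n′≤L , refl) e
    with cross-edge⇒bases m≢m′ (≤-trans 1≤lo lo≤n) (≤-trans 1≤lo′ lo′≤n′) n≤L n′≤L e | short
  ... | refl , _ | inj₁ hi≤L  = <-irrefl refl (≤-trans n<hi hi≤L)
  ... | _ , refl | inj₂ hi′≤L = <-irrefl refl (≤-trans n′<hi′ hi′≤L)

  segments-anticomplete-ordered : ∀ {m lo hi lo′ hi′ x y} → suc hi ≤ lo′ →
                                  InSegment m lo hi x → InSegment m lo′ hi′ y → ¬ x ~ y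
  segments-anticomplete-ordered hi<lo′ (n , _ , n<hi , n≤L , refl) (n′ , lo′≤n′ , _ , n′≤L , refl) e
    with vertex-~⇒consecutive n≤L n′≤L e
  ... | inj₁ refl = <-irrefl refl (≤-trans (s≤s n<hi) (≤-trans hi<lo′ lo′≤n′))
  ... | inj₂ refl = <-irrefl refl (≤-trans (n≤1+n _) (≤-trans n<hi (≤-trans (n≤1+n _) (≤-trans hi<lo′ lo′≤n′))))

  segment-edge⇒bases : ∀ {m m′ lo hi lo′ hi′ x y} → m ≢ m′ → 1 ≤ lo → 1 ≤ lo′ →
                       InSegment m lo hi x → InSegment m′ lo′ hi′ y → x ~ y → x ≡ b m × y ≡ b m′
  segment-edge⇒bases m≢m′ 1≤lo 1≤lo′ (n , lo≤n , _ , n≤L , refl) (n′ , lo′≤n′ , _ , n′≤L , refl) e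
    with cross-edge⇒bases m≢m′ (≤-trans 1≤lo lo≤n) (≤-trans 1≤lo′ lo′≤n′) n≤L n′≤L e
  ... | refl , refl = vertex-base _ , vertex-base _

  vertices-apart : ∀ {m n n′} → n′ ≤ L m → 2 + n ≤ n′ → Apart (vertex m n) (vertex m n′)
  vertices-apart n′≤L 2+n≤n′ =
    (λ eq → <⇒≢ (≤-trans (n≤1+n _) 2+n≤n′) (vertex-injective n≤L n′≤L eq)) ,
    (λ e → segments-anticomplete-ordered 2+n≤n′ (vertex-in-segment n≤L) (vertex-in-segment n′≤L) e)
    where n≤L = ≤-trans (≤-trans (n≤1+n _) (n≤1+n _)) (≤-trans 2+n≤n′ n′≤L)

  ascending : Fin 3 → ℕ → ℕ → List (V G)
  ascending m lo zero    = []
  ascending m lo (suc c) = vertex m lo ∷ ascending m (suc lo) c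

  descending : Fin 3 → ℕ → ℕ → List (V G)
  descending m lo zero    = []
  descending m lo (suc c) = vertex m (lo + c) ∷ descending m lo c

  length-ascending : ∀ m lo c → length (ascending m lo c) ≡ c
  length-ascending m lo zero    = refl
  length-ascending m lo (suc c) = cong suc (length-ascending m (suc lo) c)

  nonempty-ascending : ∀ {m lo c} → 1 ≤ c → 1 ≤ length (ascending m lo c)
  nonempty-ascending {m} {lo} {c} = subst (1 ≤_) (sym (length-ascending m lo c))

  All-ascending : ∀ {Q : V G → Set} {m} lo c → (∀ n → lo ≤ n → n < lo + c → Q (vertex m n)) →
                  All Q (ascending m lo c)
  All-ascending lo zero    f = []
  All-ascending lo (suc c) f =
    f lo ≤-refl (subst (lo <_) (sym (+-suc lo c)) (s≤s (m≤m+n lo c))) ∷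
    All-ascending (suc lo) c (λ n lo<n n<hi → f n (<⇒≤ lo<n) (subst (n <_) (sym (+-suc lo c)) n<hi))

  All-descending : ∀ {Q : V G → Set} {m} lo c → (∀ n → lo ≤ n → n < lo + c → Q (vertex m n)) →
                   All Q (descending m lo c)
  All-descending lo zero    f = []
  All-descending lo (suc c) f =
    f (lo + c) (m≤m+n lo c) (subst (lo + c <_) (sym (+-suc lo c)) ≤-refl) ∷
    All-descending lo c (λ n lo≤n n<hi → f n lo≤n (subst (n <_) (sym (+-suc lo c)) (m≤n⇒m≤1+n n<hi)))

  private
    below-bound : ∀ {m n hi} → n < hi → hi ≤ suc (L m) → n ≤ L m
    below-bound n<hi hi≤ = ≤-pred (≤-trans n<hi hi≤)

  ascending-∈ : ∀ {m} lo c {x} → lo + c ≤ suc (L m) → x ∈ₗ ascending m lo c → InSegment m lo (lo + c) x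
  ascending-∈ {m} lo c bound = All.lookup (All-ascending {InSegment m lo (lo + c)} lo c λ n lo≤n n<hi →
    n , lo≤n , n<hi , below-bound n<hi bound , refl)

  descending-∈ : ∀ {m} lo c {x} → lo + c ≤ suc (L m) → x ∈ₗ descending m lo c → InSegment m lo (lo + c) x
  descending-∈ {m} lo c bound = All.lookup (All-descending {InSegment m lo (lo + c)} lo c λ n lo≤n n<hi →
    n , lo≤n , n<hi , below-bound n<hi bound , refl)

  ascending-induced : ∀ {m} lo c → lo + c ≤ suc (L m) → Induced (ascending m lo c)
  ascending-induced lo zero          _     = tt
  ascending-induced lo (suc zero)    _     = tt , tt
  ascending-induced {m} lo (suc (suc c)) bound =
    (e , ~⇒≢ e , All-ascending (2 + lo) c (λ n 2+lo≤n n<hi → vertices-apart (below-bound n<hi bound′) 2+lo≤n)) ,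
    ascending-induced (suc lo) (suc c) (subst (_≤ suc (L m)) (+-suc lo (suc c)) bound)
    where
      bound′ : 2 + lo + c ≤ suc (L m)
      bound′ = subst (_≤ suc (L m)) (trans (+-suc lo (suc c)) (cong suc (+-suc lo c))) bound
      e = vertex-~-suc (≤-pred (≤-trans (s≤s (s≤s (m≤m+n lo c))) bound′))

  descending-induced : ∀ {m} lo c → lo + c ≤ suc (L m) → Induced (descending m lo c)
  descending-induced lo zero          _     = tt
  descending-induced lo (suc zero)    _     = tt , tt
  descending-induced {m} lo (suc (suc c)) bound =
    (~-sym e , ~⇒≢ (~-sym e) ,
       All-descending lo c (λ n _ n<hi → Apart-sym (vertices-apart top≤L (subst (2 + n ≤_) (sym (+-suc lo c)) (s≤s n<hi))))) ,
    descending-induced lo (suc c) (≤-trans (subst (lo + suc c ≤_) (sym (+-suc lo (suc c))) (n≤1+n _)) bound)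
    where
      top≤L : lo + suc c ≤ L m
      top≤L = below-bound (subst (lo + suc c <_) (sym (+-suc lo (suc c))) ≤-refl) bound
      e : vertex m (lo + c) ~ vertex m (lo + suc c)
      e = subst (λ k → vertex m (lo + c) ~ vertex m k) (sym (+-suc lo c)) (vertex-~-suc (subst (_≤ L m) (+-suc lo c) top≤L))

  ascending-joinable : ∀ {m} c ys → 1 ≤ c → (∀ n → 1 ≤ n → n < c → All (Apart (vertex m n)) ys) →
                       Attached (vertex m c) ys → Joinable (ascending m 1 c) ys
  ascending-joinable {m} (suc c) ys _ = go 1 c
    where
      go : ∀ lo c → (∀ n → lo ≤ n → n < lo + c → All (Apart (vertex m n)) ys) →
           Attached (vertex m (lo + c)) ys → Joinable (ascending m lo (suc c)) ys
      go lo zero    _ top = subst (λ k → Attached (vertex m k) ys) (+-identityʳ lo) top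
      go lo (suc c) f top =
        f lo ≤-refl (subst (lo <_) (sym (+-suc lo c)) (s≤s (m≤m+n lo c))) ,
        go (suc lo) c (λ n lo<n n<hi → f n (<⇒≤ lo<n) (subst (n <_) (sym (+-suc lo c)) n<hi))
          (subst (λ k → Attached (vertex m k) ys) (+-suc lo c) top)

  descending-joinable : ∀ {m} lo c ys → (∀ n → lo < n → n ≤ lo + c → All (Apart (vertex m n)) ys) →
                        Attached (vertex m lo) ys → Joinable (descending m lo (suc c)) ys
  descending-joinable {m} lo zero    ys _ bottom = subst (λ k → Attached (vertex m k) ys) (sym (+-identityʳ lo)) bottom
  descending-joinable lo (suc c) ys f bottom =
    f (lo + suc c) (subst (lo <_) (sym (+-suc lo c)) (s≤s (m≤m+n lo c))) ≤-refl ,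
    descending-joinable lo c ys
      (λ n lo<n n≤top → f n lo<n (≤-trans n≤top (subst (lo + c ≤_) (sym (+-suc lo c)) (n≤1+n _)))) bottom

  cross-apart : ∀ {m m′ n n′} → m ≢ m′ → 1 ≤ n → 1 ≤ n′ → n ≤ L m → n′ ≤ L m′ →
                n < L m ⊎ n′ < L m′ →
                Apart (vertex m n) (vertex m′ n′)
  cross-apart {m′ = m′} m≢m′ 1≤n 1≤n′ n≤L n′≤L short =
    segments-disjoint m≢m′ 1≤n (vertex-in-segment n≤L) (vertex-in-segment n′≤L) ,
    segments-anticomplete m≢m′ 1≤n 1≤n′ short (vertex-in-segment n≤L) (vertex-in-segment n′≤L)

  from-base : Fin 3 → ℕ → List (V G)
  from-base m n = descending m n (suc (L m ∸ n))

  from-base-bound : ∀ {m n} → n ≤ L m → n + suc (L m ∸ n) ≡ suc (L m)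
  from-base-bound {m} {n} n≤L = trans (+-suc n (L m ∸ n)) (cong suc (m+[n∸m]≡n n≤L))

  from-base-∈ : ∀ {m n x} → n ≤ L m → x ∈ₗ from-base m n → InSegment m n (suc (L m)) x
  from-base-∈ {m} {n} {x} n≤L h =
    subst (λ hi → InSegment m n hi x) (from-base-bound n≤L) (descending-∈ n _ (≤-reflexive (from-base-bound n≤L)) h)

  from-base-induced : ∀ {m n} → n ≤ L m → Induced (from-base m n)
  from-base-induced n≤L = descending-induced _ _ (≤-reflexive (from-base-bound n≤L))

  to-base : Fin 3 → ℕ → List (V G)
  to-base m n = ascending m n (suc (L m ∸ n))

  to-base-∈ : ∀ {m n x} → n ≤ L m → x ∈ₗ to-base m n → InSegment m n (suc (L m)) x
  to-base-∈ {m} {n} {x} n≤L h =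
    subst (λ hi → InSegment m n hi x) (from-base-bound n≤L) (ascending-∈ n _ (≤-reflexive (from-base-bound n≤L)) h)

  to-base-induced : ∀ {m n} → n ≤ L m → Induced (to-base m n)
  to-base-induced n≤L = ascending-induced _ _ (≤-reflexive (from-base-bound n≤L))

  lastOf-ascending : ∀ m lo c → lastOf (vertex m lo) (ascending m (suc lo) c) ≡ vertex m (lo + c)
  lastOf-ascending m lo zero    = cong (vertex m) (sym (+-identityʳ lo))
  lastOf-ascending m lo (suc c) = trans (lastOf-ascending m (suc lo) c) (cong (vertex m) (sym (+-suc lo c)))

  lastOf-to-base : ∀ {m n} → n ≤ L m → lastOf (vertex m n) (ascending m (suc n) (L m ∸ n)) ≡ b m
  lastOf-to-base {m} {n} n≤L = trans (lastOf-ascending m n _) (trans (cong (vertex m) (m+[n∸m]≡n n≤L)) (vertex-base m))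

  lastOf-++-ascending : ∀ {m} x xs → lastOf x (xs ++ ascending m 1 (L m)) ≡ b m
  lastOf-++-ascending {m} x xs = trans (go xs (L m) (1≤L m)) (vertex-base m)
    where
      go : ∀ xs c → 1 ≤ c → lastOf x (xs ++ ascending m 1 c) ≡ vertex m c
      go xs (suc c) _ = trans (lastOf-++ x xs (vertex m 1) (ascending m 2 c)) (lastOf-ascending m 1 c)

  apex-or-above : ∀ {m hi v} → InSegment m 0 hi v → v ≡ a ⊎ InSegment m 1 hi v
  apex-or-above {m} (zero  , _ , _ , _ , refl)         = inj₁ (vertex-apex m)
  apex-or-above     (suc n , _ , n<hi , n≤L , refl) = inj₂ (suc n , s≤s z≤n , n<hi , n≤L , refl)

  descending-split : ∀ m lo c → descending m lo (suc c) ≡ descending m (suc lo) c ++ vertex m lo ∷ []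
  descending-split m lo zero    = cong (λ k → vertex m k ∷ []) (+-identityʳ lo)
  descending-split m lo (suc c) = cong₂ _∷_ (cong (vertex m) (+-suc lo c)) (descending-split m lo c)

  base-∈ : ∀ m → _∈P_ G (b m) (P m)
  base-∈ m = subst (λ v → _∈P_ G v (P m)) (vertex-base m) (vertex-∈ m (L m))

  base-∈⇒≡ : ∀ {l m} → _∈P_ G (b l) (P m) → l ≡ m
  base-∈⇒≡ {l} {m} bl∈ with l Fin.≟ m
  ... | yes l≡m = l≡m
  ... | no  l≢m with ∈⇒vertex bl∈
  ...   | n , _ , vn≡bl = contradiction (shared-vertex-is-apex l≢m ≤-refl (trans (vertex-base l) (sym vn≡bl)))
                                        (<⇒≢ (1≤L l) ∘ sym)

  neighbour-of-base : ∀ m → ∃ λ v → _∈P_ G v (P m) × v ~ b m × ∀ l → v ≢ b l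
  neighbour-of-base m with m≤n⇒∃[o]m+o≡n (1≤L m)
  ... | c , 1+c≡L = vertex m c , vertex-∈ m c , c~b , not-base
    where
      c~b : vertex m c ~ b m
      c~b = subst (vertex m c ~_) (trans (cong (vertex m) 1+c≡L) (vertex-base m)) (vertex-~-suc (≤-reflexive 1+c≡L))

      not-base : ∀ l → vertex m c ≢ b l
      not-base l eq with base-∈⇒≡ (subst (λ v → _∈P_ G v (P m)) eq (vertex-∈ m c))
      ... | refl = <-irrefl (vertex-injective (≤-trans (n≤1+n c) (≤-reflexive 1+c≡L)) ≤-refl (trans eq (sym (vertex-base l))))
                            (≤-reflexive 1+c≡L)

module Attachments (G : Graph) {a : V G} {b : Fin 3 → V G} {P : Fin 3 → Path G}
                   (pyramid : IsPyramid G a b P) (p : V G)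
                   (p∉Σ : ∀ m v → _∈P_ G v (P m) → v ≢ p)
                   (p≁a : ¬ Edge G p a) (p≁N[a] : ∀ v → Edge G a v → ¬ Edge G p v) where
  open InducedLists G
  open PyramidCoordinates G {a} {b} {P} pyramid

  vertex≢p : ∀ m n → vertex m n ≢ p
  vertex≢p m n = p∉Σ m _ (vertex-∈ m n)

  segment-avoids-p : ∀ {m lo hi x} → InSegment m lo hi x → x ≢ p
  segment-avoids-p (n , _ , _ , _ , refl) = vertex≢p _ n

  apex-apart : ∀ {m n} → 2 ≤ n → n ≤ L m → Apart a (vertex m n)
  apex-apart 2≤n n≤L =
    vertex≢apex (≤-trans (n≤1+n 1) 2≤n) n≤L ∘ sym , apex-anticomplete-segment 2≤n (vertex-in-segment n≤L)

  Untouched : Fin 3 → Set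
  Untouched m = ∀ n → n ≤ L m → ¬ p ~ vertex m n

  record Span (m : Fin 3) : Set where
    field
      top bottom   : ℕ
      2≤top        : 2 ≤ top
      top≤bottom   : top ≤ bottom
      bottom≤L     : bottom ≤ L m
      top-~        : p ~ vertex m top
      bottom-~     : p ~ vertex m bottom
      below-top    : ∀ n → n < top → ¬ p ~ vertex m n
      above-bottom : ∀ n → bottom < n → n ≤ L m → ¬ p ~ vertex m n

    top≤L : top ≤ L m
    top≤L = ≤-trans top≤bottom bottom≤L

    neighbour-in-span : ∀ {n} → n ≤ L m → p ~ vertex m n → top ≤ n × n ≤ bottom
    neighbour-in-span n≤L e =
      ≮⇒≥ (λ n<top → below-top _ n<top e) , ≮⇒≥ (λ bottom<n → above-bottom _ bottom<n n≤L e)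

    two-neighbours : bottom ≡ suc top → ∀ {n} → n ≤ L m → p ~ vertex m n → n ≡ top ⊎ n ≡ suc top
    two-neighbours eq n≤L e with m≤n⇒m<n∨m≡n (proj₁ (neighbour-in-span n≤L e))
    ... | inj₁ top<n  = inj₂ (≤-antisym (subst (_ ≤_) eq (proj₂ (neighbour-in-span n≤L e))) top<n)
    ... | inj₂ top≡n  = inj₁ (sym top≡n)

  open Span

  untouched-or-span : ∀ m → Untouched m ⊎ Span m
  untouched-or-span m with least-witness (λ n → p ~? vertex m n) (L m)
  ... | inj₁ none = inj₁ none
  ... | inj₂ (0 , _ , e , _) = ⊥-elim (p≁a (subst (p ~_) (vertex-apex m) e))
  ... | inj₂ (1 , _ , e , _) = ⊥-elim (p≁N[a] _ (apex-~-vertex₁ m) e)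
  ... | inj₂ (suc (suc t) , t≤L , top-~ , below-top) with greatest-witness (λ n → p ~? vertex m n) (L m)
  ...   | inj₁ none = ⊥-elim (none _ t≤L top-~)
  ...   | inj₂ (s , s≤L , bottom-~ , above-bottom) = inj₂ (record
    { top = suc (suc t) ; bottom = s ; 2≤top = s≤s (s≤s z≤n)
    ; top≤bottom = ≮⇒≥ (λ s<top → below-top s s<top bottom-~) ; bottom≤L = s≤L
    ; top-~ = top-~ ; bottom-~ = bottom-~ ; below-top = below-top ; above-bottom = above-bottom })

  apex≢p : a ≢ p
  apex≢p = subst (_≢ p) (vertex-apex 0F) (vertex≢p 0F 0)

  apex-attached : ∀ {m} t → 1 ≤ t → t ≤ L m → Attached a (ascending m 1 t)
  apex-attached {m} (suc c) _ t≤L =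
    apex-~-vertex₁ m , ~⇒≢ (apex-~-vertex₁ m) ,
    All-ascending 2 c (λ n 2≤n n<t → apex-apart 2≤n (≤-trans (≤-pred n<t) t≤L))

  apex-∷-induced : ∀ {m} t zs → 1 ≤ t → t ≤ L m → All (Apart a) zs → Induced (ascending m 1 t ++ zs) →
              Induced (a ∷ ascending m 1 t ++ zs)
  apex-∷-induced {m} t zs 1≤t t≤L a-zs I =
    attached-++ (ascending m 1 t) zs (nonempty-ascending 1≤t)
                (apex-attached t 1≤t t≤L) a-zs , I

  ascending-∷ʳ-induced : ∀ {m} t x → 1 ≤ t → t ≤ L m → vertex m t ~ x → vertex m t ≢ x →
                   (∀ n → 1 ≤ n → n < t → Apart (vertex m n) x) → Induced (ascending m 1 t ++ x ∷ [])
  ascending-∷ʳ-induced {m} (suc c) x _ t≤L e ne apart =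
    ++-induced (ascending m 1 (suc c)) (x ∷ []) (ascending-induced 1 (suc c) (s≤s t≤L)) (tt , tt)
      (ascending-joinable (suc c) (x ∷ []) (s≤s z≤n) (λ n 1≤n n<t → apart n 1≤n n<t ∷ []) (e , ne , []))

  climb : ∀ {m} → Span m → Branch a p
  climb {m} S = record
    { interior = ascending m 1 (top S)
    ; nonempty = nonempty-ascending 1≤top
    ; induced  = apex-∷-induced (top S) (p ∷ []) 1≤top (top≤L S) ((apex≢p , p≁a ∘ ~-sym) ∷ [])
                   (ascending-∷ʳ-induced (top S) p 1≤top (top≤L S) (~-sym (top-~ S)) (vertex≢p m _)
                      (λ n _ n<top → vertex≢p m n , below-top S n n<top ∘ ~-sym))
    }
    where 1≤top = ≤-trans (n≤1+n 1) (2≤top S)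

  climb-∈ : ∀ {m v} (S : Span m) → v ∈ₗ interior (climb S) → InSegment m 1 (suc (top S)) v
  climb-∈ S = ascending-∈ 1 (top S) (s≤s (top≤L S))

  along : ∀ m n → 2 ≤ n → n ≤ L m → Branch a (vertex m n)
  along m (suc n) (s≤s 1≤n) n<L = record
    { interior = ascending m 1 n
    ; nonempty = nonempty-ascending 1≤n
    ; induced  = apex-∷-induced n (vertex m (suc n) ∷ []) 1≤n (<⇒≤ n<L) (apex-apart (s≤s 1≤n) n<L ∷ [])
                   (ascending-∷ʳ-induced n _ 1≤n (<⇒≤ n<L) (vertex-~-suc n<L) (~⇒≢ (vertex-~-suc n<L))
                      (λ k _ k<n → vertices-apart n<L (s≤s k<n)))
    }

  along-∈ : ∀ {m n 2≤n n≤L v} → v ∈ₗ interior (along m n 2≤n n≤L) → InSegment m 1 n v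
  along-∈ {m} {suc n} {s≤s _} {n<L} = ascending-∈ 1 n (s≤s (<⇒≤ n<L))

  theta-from-tops : (S : ∀ m → Span m) → (∀ m m′ → m ≢ m′ → top (S m) < L m ⊎ top (S m′) < L m′) → HasTheta G
  theta-from-tops S short =
    theta-from-branches (climb (S 0F)) (climb (S 1F)) (climb (S 2F))
      (disjoint (λ ())) (disjoint (λ ())) (disjoint (λ ()))
      (anticomplete (λ ())) (anticomplete (λ ())) (anticomplete (λ ()))
    where
      disjoint : ∀ {m m′} → m ≢ m′ → Disjoint (interior (climb (S m))) (interior (climb (S m′)))
      disjoint {m} {m′} m≢m′ (h , h′) =
        segments-disjoint m≢m′ (s≤s z≤n) (climb-∈ (S m) h) (climb-∈ (S m′) h′) refl

      anticomplete : ∀ {m m′} → m ≢ m′ → Anticomplete (interior (climb (S m))) (interior (climb (S m′)))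
      anticomplete {m} {m′} m≢m′ h h′ =
        segments-anticomplete m≢m′ (s≤s z≤n) (s≤s z≤n) (short m m′ m≢m′) (climb-∈ (S m) h) (climb-∈ (S m′) h′)

  over-base-induced : ∀ {k j} → k ≢ j → ∀ n zs → 2 ≤ n → n ≤ L j →
              Induced (from-base j n ++ zs) → All (Apart a) zs →
              (∀ n′ → 1 ≤ n′ → n′ ≤ L k → All (Apart (vertex k n′)) zs) →
              Induced (a ∷ ascending k 1 (L k) ++ from-base j n ++ zs)
  over-base-induced {k} {j} k≢j n zs 2≤n n≤L I a-zs k-zs =
    apex-∷-induced (L k) (from-base j n ++ zs) (1≤L k) ≤-refl
      (++⁺ (All-descending n _ λ n′ n≤n′ n′<hi → apex-apart (≤-trans 2≤n n≤n′) (below n′<hi)) a-zs)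
      (++-induced (ascending k 1 (L k)) _ (ascending-induced 1 (L k) ≤-refl) I
        (ascending-joinable (L k) _ (1≤L k)
           (λ n′ 1≤n′ n′<L → ++⁺ (P-k-apart n′ 1≤n′ n′<L) (k-zs n′ 1≤n′ (<⇒≤ n′<L)))
          (bases-~ , ~⇒≢ bases-~ , ++⁺ b-k-apart (k-zs (L k) (1≤L k) ≤-refl))))
    where
      1≤n = ≤-trans (n≤1+n 1) 2≤n

      below : ∀ {n′} → n′ < n + suc (L j ∸ n) → n′ ≤ L j
      below {n′} n′<hi = ≤-pred (subst (n′ <_) (from-base-bound n≤L) n′<hi)

      P-k-apart : ∀ n′ → 1 ≤ n′ → n′ < L k → All (Apart (vertex k n′)) (from-base j n)
      P-k-apart n′ 1≤n′ n′<L = All-descending n _ λ n″ n≤n″ n″<hi →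
        cross-apart k≢j 1≤n′ (≤-trans 1≤n n≤n″) (<⇒≤ n′<L) (below n″<hi) (inj₁ n′<L)

      bases-~ : vertex k (L k) ~ vertex j (n + (L j ∸ n))
      bases-~ = base-~ k≢j refl (m+[n∸m]≡n n≤L)

      b-k-apart : All (Apart (vertex k (L k))) (descending j n (L j ∸ n))
      b-k-apart = All-descending n _ λ n″ n≤n″ n″<hi →
        let n″<L = subst (n″ <_) (m+[n∸m]≡n n≤L) n″<hi
        in cross-apart k≢j (1≤L k) (≤-trans 1≤n n≤n″) ≤-refl (<⇒≤ n″<L) (inj₂ n″<L)

  -- j has a single neighbour y of p: a theta between a and y, through p along P_i and through b_k b_j.
  module SoleNeighbourTheta {i j k} (i≢j : i ≢ j) (i≢k : i ≢ k) (j≢k : j ≢ k) (k-untouched : Untouched k)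
                            (Si : Span i) (ti<L : top Si < L i) (Sj : Span j) (sole : bottom Sj ≡ top Sj) where
    ti = top Si
    tj = top Sj
    y  = vertex j tj

    1≤ti : 1 ≤ ti
    1≤ti = ≤-trans (n≤1+n 1) (2≤top Si)

    1≤tj : 1 ≤ tj
    1≤tj = ≤-trans (n≤1+n 1) (2≤top Sj)

    branch₀ : Branch a y
    branch₀ = along j tj (2≤top Sj) (top≤L Sj)

    branch₁ : Branch a y
    branch₁ = record
      { interior = ascending i 1 ti ++ p ∷ []
      ; nonempty = ≤-trans (nonempty-ascending 1≤ti) (length-++-≤ˡ (ascending i 1 ti))
      ; induced  = subst (λ xs → Induced (a ∷ xs)) (sym (++-assoc (ascending i 1 ti) (p ∷ []) (y ∷ [])))
                     (apex-∷-induced ti (p ∷ y ∷ []) 1≤ti (top≤L Si)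
                        ((apex≢p , p≁a ∘ ~-sym) ∷ apex-apart (2≤top Sj) (top≤L Sj) ∷ [])
                        (++-induced (ascending i 1 ti) (p ∷ y ∷ []) (ascending-induced 1 ti (s≤s (top≤L Si)))
                           ((top-~ Sj , vertex≢p j tj ∘ sym , []) , tt , tt)
                           (ascending-joinable ti _ 1≤ti
                              (λ n 1≤n n<ti → (vertex≢p i n , below-top Si n n<ti ∘ ~-sym) ∷
                                              cross-apart i≢j 1≤n 1≤tj (<⇒≤ (≤-trans n<ti (top≤L Si))) (top≤L Sj)
                                                          (inj₁ (≤-trans n<ti (<⇒≤ ti<L))) ∷ [])
                              (~-sym (top-~ Si) , vertex≢p i ti ,
                               cross-apart i≢j 1≤ti 1≤tj (top≤L Si) (top≤L Sj) (inj₁ ti<L) ∷ []))))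
      }

    d = L j ∸ tj

    branch₂ : Branch a y
    branch₂ = record
      { interior = ascending k 1 (L k) ++ descending j (suc tj) d
      ; nonempty = ≤-trans (nonempty-ascending (1≤L k)) (length-++-≤ˡ (ascending k 1 (L k)))
      ; induced  = subst (λ xs → Induced (a ∷ xs)) path≡
                     (over-base-induced (j≢k ∘ sym) tj [] (2≤top Sj) (top≤L Sj)
                        (subst Induced (sym (++-identityʳ _)) (from-base-induced (top≤L Sj))) [] (λ _ _ _ → []))
      }
      where
        path≡ : ascending k 1 (L k) ++ from-base j tj ++ [] ≡ (ascending k 1 (L k) ++ descending j (suc tj) d) ++ y ∷ []
        path≡ = begin
          ascending k 1 (L k) ++ from-base j tj ++ []                ≡⟨ cong (ascending k 1 (L k) ++_) (++-identityʳ _) ⟩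
          ascending k 1 (L k) ++ from-base j tj                      ≡⟨ cong (ascending k 1 (L k) ++_) (descending-split j tj d) ⟩
          ascending k 1 (L k) ++ descending j (suc tj) d ++ y ∷ []   ≡⟨ ++-assoc (ascending k 1 (L k)) _ _ ⟨
          (ascending k 1 (L k) ++ descending j (suc tj) d) ++ y ∷ [] ∎
          where open ≡-Reasoning

    ∈₀ : ∀ {v} → v ∈ₗ interior branch₀ → InSegment j 1 tj v
    ∈₀ = along-∈

    ∈₁ : ∀ {v} → v ∈ₗ interior branch₁ → InSegment i 1 (suc ti) v ⊎ v ≡ p
    ∈₁ h with ∈-++⁻ (ascending i 1 ti) h
    ... | inj₁ h′        = inj₁ (ascending-∈ 1 ti (s≤s (top≤L Si)) h′)
    ... | inj₂ (here eq) = inj₂ eq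

    ∈₂ : ∀ {v} → v ∈ₗ interior branch₂ → InSegment k 1 (suc (L k)) v ⊎ InSegment j (suc tj) (suc tj + d) v
    ∈₂ h with ∈-++⁻ (ascending k 1 (L k)) h
    ... | inj₁ h′ = inj₁ (ascending-∈ 1 (L k) ≤-refl h′)
    ... | inj₂ h′ = inj₂ (descending-∈ (suc tj) d (s≤s (≤-reflexive (m+[n∸m]≡n (top≤L Sj)))) h′)

    theta : HasTheta G
    theta = theta-from-branches branch₀ branch₁ branch₂ d₀₁ d₀₂ d₁₂ a₀₁ a₀₂ a₁₂
      where
        d₀₁ : Disjoint (interior branch₀) (interior branch₁)
        d₀₁ (h , h′) with ∈₁ h′
        ... | inj₁ q    = segments-disjoint (i≢j ∘ sym) (s≤s z≤n) (∈₀ h) q refl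
        ... | inj₂ refl = segment-avoids-p (∈₀ h) refl

        d₀₂ : Disjoint (interior branch₀) (interior branch₂)
        d₀₂ (h , h′) with ∈₂ h′
        ... | inj₁ q = segments-disjoint j≢k (s≤s z≤n) (∈₀ h) q refl
        ... | inj₂ q = segments-disjoint-ordered (n≤1+n tj) (∈₀ h) q refl

        d₁₂ : Disjoint (interior branch₁) (interior branch₂)
        d₁₂ (h , h′) with ∈₁ h | ∈₂ h′
        ... | inj₁ q    | inj₁ r = segments-disjoint i≢k (s≤s z≤n) q r refl
        ... | inj₁ q    | inj₂ r = segments-disjoint i≢j (s≤s z≤n) q r refl
        ... | inj₂ refl | inj₁ r = segment-avoids-p r refl
        ... | inj₂ refl | inj₂ r = segment-avoids-p r refl

        a₀₁ : Anticomplete (interior branch₀) (interior branch₁)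
        a₀₁ h h′ e with ∈₀ h | ∈₁ h′
        ... | q                        | inj₁ r    =
          segments-anticomplete (i≢j ∘ sym) (s≤s z≤n) (s≤s z≤n) (inj₁ (top≤L Sj)) q r e
        ... | (n , _ , n<tj , _ , refl) | inj₂ refl = below-top Sj n n<tj (~-sym e)

        a₀₂ : Anticomplete (interior branch₀) (interior branch₂)
        a₀₂ h h′ with ∈₂ h′
        ... | inj₁ r = segments-anticomplete j≢k (s≤s z≤n) (s≤s z≤n) (inj₁ (top≤L Sj)) (∈₀ h) r
        ... | inj₂ r = segments-anticomplete-ordered ≤-refl (∈₀ h) r

        a₁₂ : Anticomplete (interior branch₁) (interior branch₂)
        a₁₂ h h′ e with ∈₁ h | ∈₂ h′
        ... | inj₁ q    | inj₁ r = segments-anticomplete i≢k (s≤s z≤n) (s≤s z≤n) (inj₁ ti<L) q r e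
        ... | inj₁ q    | inj₂ r = segments-anticomplete i≢j (s≤s z≤n) (s≤s z≤n) (inj₁ ti<L) q r e
        ... | inj₂ refl | inj₁ (n , _ , _ , n≤L , refl)       = k-untouched n n≤L e
        ... | inj₂ refl | inj₂ (n , tj<n , _ , n≤L , refl)    = above-bottom Sj n (subst (_< n) (sym sole) tj<n) n≤L e

  -- The neighbours of p on P_i are not consecutive: a theta between a and p, the third branch through b_k b_i.
  module BaseTheta {i j k} (i≢j : i ≢ j) (i≢k : i ≢ k) (j≢k : j ≢ k) (k-untouched : Untouched k)
                   (Si : Span i) (gap : 2 + top Si ≤ bottom Si) (Sj : Span j) (tj<L : top Sj < L j) where
    si = bottom Si

    ti<L : top Si < L i
    ti<L = ≤-trans (n≤1+n _) (≤-trans gap (bottom≤L Si))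

    2≤si : 2 ≤ si
    2≤si = ≤-trans (2≤top Si) (top≤bottom Si)

    down-to-p : Induced (from-base i si ++ p ∷ [])
    down-to-p = ++-induced (from-base i si) (p ∷ []) (from-base-induced (bottom≤L Si)) (tt , tt)
      (descending-joinable si (L i ∸ si) (p ∷ [])
        (λ n si<n n≤L →
          (vertex≢p i n , above-bottom Si n si<n (subst (n ≤_) (m+[n∸m]≡n (bottom≤L Si)) n≤L) ∘ ~-sym) ∷ [])
        (~-sym (bottom-~ Si) , vertex≢p i si , []))

    branch₂ : Branch a p
    branch₂ = record
      { interior = ascending k 1 (L k) ++ from-base i si
      ; nonempty = ≤-trans (nonempty-ascending (1≤L k)) (length-++-≤ˡ (ascending k 1 (L k)))
      ; induced  = subst (λ xs → Induced (a ∷ xs)) (sym (++-assoc (ascending k 1 (L k)) (from-base i si) (p ∷ [])))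
                     (over-base-induced (i≢k ∘ sym) si (p ∷ []) 2≤si (bottom≤L Si) down-to-p
                        ((apex≢p , p≁a ∘ ~-sym) ∷ [])
                        (λ n _ n≤L → (vertex≢p k n , k-untouched n n≤L ∘ ~-sym) ∷ []))
      }

    ∈₂ : ∀ {v} → v ∈ₗ interior branch₂ → InSegment k 1 (suc (L k)) v ⊎ InSegment i si (suc (L i)) v
    ∈₂ h with ∈-++⁻ (ascending k 1 (L k)) h
    ... | inj₁ h′ = inj₁ (ascending-∈ 1 (L k) ≤-refl h′)
    ... | inj₂ h′ = inj₂ (from-base-∈ (bottom≤L Si) h′)

    theta : HasTheta G
    theta = theta-from-branches (climb Si) (climb Sj) branch₂ d₀₁ d₀₂ d₁₂ a₀₁ a₀₂ a₁₂
      where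
        d₀₁ : Disjoint (interior (climb Si)) (interior (climb Sj))
        d₀₁ (h , h′) = segments-disjoint i≢j (s≤s z≤n) (climb-∈ Si h) (climb-∈ Sj h′) refl

        d₀₂ : Disjoint (interior (climb Si)) (interior branch₂)
        d₀₂ (h , h′) with ∈₂ h′
        ... | inj₁ r = segments-disjoint i≢k (s≤s z≤n) (climb-∈ Si h) r refl
        ... | inj₂ r = segments-disjoint-ordered (≤-trans (n≤1+n _) gap) (climb-∈ Si h) r refl

        d₁₂ : Disjoint (interior (climb Sj)) (interior branch₂)
        d₁₂ (h , h′) with ∈₂ h′
        ... | inj₁ r = segments-disjoint j≢k (s≤s z≤n) (climb-∈ Sj h) r refl
        ... | inj₂ r = segments-disjoint (i≢j ∘ sym) (s≤s z≤n) (climb-∈ Sj h) r refl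

        a₀₁ : Anticomplete (interior (climb Si)) (interior (climb Sj))
        a₀₁ h h′ = segments-anticomplete i≢j (s≤s z≤n) (s≤s z≤n) (inj₁ ti<L) (climb-∈ Si h) (climb-∈ Sj h′)

        a₀₂ : Anticomplete (interior (climb Si)) (interior branch₂)
        a₀₂ h h′ with ∈₂ h′
        ... | inj₁ r = segments-anticomplete i≢k (s≤s z≤n) (s≤s z≤n) (inj₁ ti<L) (climb-∈ Si h) r
        ... | inj₂ r = segments-anticomplete-ordered gap (climb-∈ Si h) r

        a₁₂ : Anticomplete (interior (climb Sj)) (interior branch₂)
        a₁₂ h h′ with ∈₂ h′
        ... | inj₁ r = segments-anticomplete j≢k (s≤s z≤n) (s≤s z≤n) (inj₁ tj<L) (climb-∈ Sj h) r
        ... | inj₂ r =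
          segments-anticomplete (i≢j ∘ sym) (s≤s z≤n) (≤-trans (n≤1+n 1) 2≤si) (inj₁ tj<L) (climb-∈ Sj h) r

  -- p sees exactly an edge of P_i that misses b_i: a prism with triangles p, that edge and b₁ b₂ b₃.
  module EdgePrism {i j k} (i≢j : i ≢ j) (i≢k : i ≢ k) (j≢k : j ≢ k) (k-untouched : Untouched k)
                   (Si : Span i) (consecutive : bottom Si ≡ suc (top Si)) (above-base : suc (top Si) < L i)
                   (Sj : Span j) where
    t  = top Si
    sj = bottom Sj

    1≤sj : 1 ≤ sj
    1≤sj = ≤-trans (n≤1+n 1) (≤-trans (2≤top Sj) (top≤bottom Sj))

    p-neighbours : ∀ {n} → n ≤ L i → p ~ vertex i n → n ≡ t ⊎ n ≡ suc t
    p-neighbours = two-neighbours Si consecutive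

    rail₀ : Rail
    rail₀ = record
      { first    = p
      ; rest     = to-base j sj
      ; nonempty = s≤s z≤n
      ; induced  = (bottom-~ Sj , vertex≢p j sj ∘ sym ,
                    All-ascending (suc sj) _ (λ n sj<n n<hi →
                      vertex≢p j n ∘ sym , above-bottom Sj n sj<n (subst (n ≤_) (m+[n∸m]≡n (bottom≤L Sj)) (≤-pred n<hi)))) ,
                   to-base-induced (bottom≤L Sj)
      }

    rail₁ : Rail
    rail₁ = record
      { first    = vertex i t
      ; rest     = descending i 0 t ++ ascending k 1 (L k)
      ; nonempty = ≤-trans (nonempty-ascending (1≤L k))
                           (length-++-≤ʳ (ascending k 1 (L k)) {descending i 0 t})
      ; induced  = ++-induced (descending i 0 (suc t)) (ascending k 1 (L k))
                     (descending-induced 0 (suc t) (s≤s (top≤L Si))) (ascending-induced 1 (L k) ≤-refl)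
                     (descending-joinable 0 t _
                        (λ n 0<n n≤t → All-ascending 1 (L k) λ n′ 1≤n′ n′<hi →
                           cross-apart i≢k 0<n 1≤n′ (≤-trans n≤t (top≤L Si)) (≤-pred n′<hi)
                                       (inj₁ (≤-trans (s≤s n≤t) (<⇒≤ above-base))))
                        (subst (λ v → Attached v (ascending k 1 (L k))) (sym (vertex-apex i))
                           (apex-attached (L k) (1≤L k) ≤-refl)))
      }

    rail₂ : Rail
    rail₂ = record
      { first    = vertex i (suc t)
      ; rest     = ascending i (2 + t) (L i ∸ suc t)
      ; nonempty = nonempty-ascending (m<n⇒0<n∸m above-base)
      ; induced  = to-base-induced (<⇒≤ above-base)
      }

    final₀ : final rail₀ ≡ b j
    final₀ = lastOf-to-base (bottom≤L Sj)

    final₁ : final rail₁ ≡ b k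
    final₁ = lastOf-++-ascending (vertex i t) (descending i 0 t)

    final₂ : final rail₂ ≡ b i
    final₂ = lastOf-to-base (<⇒≤ above-base)

    ∈₁ : ∀ {v} → v ∈ₗ first rail₁ ∷ rest rail₁ → InSegment i 0 (suc t) v ⊎ InSegment k 1 (suc (L k)) v
    ∈₁ h with ∈-++⁻ (descending i 0 (suc t)) h
    ... | inj₁ h′ = inj₁ (descending-∈ 0 (suc t) (s≤s (top≤L Si)) h′)
    ... | inj₂ h′ = inj₂ (ascending-∈ 1 (L k) ≤-refl h′)

    ∈₂ : ∀ {v} → v ∈ₗ first rail₂ ∷ rest rail₂ → InSegment i (suc t) (suc (L i)) v
    ∈₂ = to-base-∈ (<⇒≤ above-base)

    to-finals : ∀ {R R′ : Rail} {m m′ u v} → final R ≡ b m → final R′ ≡ b m′ →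
                u ≡ b m × v ≡ b m′ → u ≡ final R × v ≡ final R′
    to-finals f f′ (u≡b , v≡b′) = trans u≡b (sym f) , trans v≡b′ (sym f′)

    lower-neighbour : ∀ {v} → InSegment i 0 (suc t) v → p ~ v → v ≡ vertex i t
    lower-neighbour (n , _ , n<1+t , n≤L , refl) e with p-neighbours n≤L e
    ... | inj₁ refl = refl
    ... | inj₂ refl = ⊥-elim (<-irrefl refl n<1+t)

    upper-neighbour : ∀ {v} → InSegment i (suc t) (suc (L i)) v → p ~ v → v ≡ vertex i (suc t)
    upper-neighbour (n , 1+t≤n , _ , n≤L , refl) e with p-neighbours n≤L e
    ... | inj₁ refl = ⊥-elim (<-irrefl refl 1+t≤n)
    ... | inj₂ refl = refl

    middle-edge : ∀ {u v} → InSegment i 0 (suc t) u → InSegment i (suc t) (suc (L i)) v → u ~ v →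
                  u ≡ vertex i t × v ≡ vertex i (suc t)
    middle-edge (n , _ , n<1+t , n≤L , refl) (n′ , 1+t≤n′ , _ , n′≤L , refl) e with vertex-~⇒consecutive n≤L n′≤L e
    ... | inj₁ refl =
      let n≡t = ≤-antisym (≤-pred n<1+t) (≤-pred 1+t≤n′) in cong (vertex i) n≡t , cong (vertex i ∘ suc) n≡t
    ... | inj₂ refl = ⊥-elim (<-irrefl refl (≤-trans n<1+t (≤-trans 1+t≤n′ (n≤1+n _))))

    L₀₁ : Linked rail₀ rail₁
    L₀₁ (here refl) h′ with ∈₁ h′
    ... | inj₁ q = segment-avoids-p q ∘ sym , λ e → inj₁ (refl , lower-neighbour q e)
    ... | inj₂ r@(n , _ , _ , n≤L , refl) = segment-avoids-p r ∘ sym , λ e → ⊥-elim (k-untouched n n≤L e)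
    L₀₁ (there h) h′ with to-base-∈ (bottom≤L Sj) h | ∈₁ h′
    ... | q | inj₂ r =
      segments-disjoint j≢k 1≤sj q r ,
      λ e → inj₂ (to-finals {rail₀} {rail₁} final₀ final₁ (segment-edge⇒bases j≢k 1≤sj (s≤s z≤n) q r e))
    ... | q | inj₁ r with apex-or-above r
    ...   | inj₁ refl = segment-avoids-apex 1≤sj q , λ e → ⊥-elim (apex-anticomplete-segment 2≤sj q (~-sym e))
      where 2≤sj = ≤-trans (2≤top Sj) (top≤bottom Sj)
    ...   | inj₂ r′ =
      segments-disjoint (i≢j ∘ sym) 1≤sj q r′ ,
      λ e → ⊥-elim (segments-anticomplete (i≢j ∘ sym) 1≤sj (s≤s z≤n) (inj₂ (<⇒≤ above-base)) q r′ e)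

    L₀₂ : Linked rail₀ rail₂
    L₀₂ (here refl) h′ = segment-avoids-p (∈₂ h′) ∘ sym , λ e → inj₁ (refl , upper-neighbour (∈₂ h′) e)
    L₀₂ (there h) h′ =
      segments-disjoint (i≢j ∘ sym) 1≤sj q (∈₂ h′) ,
      λ e → inj₂ (to-finals {rail₀} {rail₂} final₀ final₂
                    (segment-edge⇒bases (i≢j ∘ sym) 1≤sj (s≤s z≤n) q (∈₂ h′) e))
      where q = to-base-∈ (bottom≤L Sj) h

    L₁₂ : Linked rail₁ rail₂
    L₁₂ h h′ with ∈₁ h
    ... | inj₁ q = segments-disjoint-ordered ≤-refl q (∈₂ h′) , λ e → inj₁ (middle-edge q (∈₂ h′) e)
    ... | inj₂ q =
      segments-disjoint (i≢k ∘ sym) (s≤s z≤n) q (∈₂ h′) ,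
      λ e → inj₂ (to-finals {rail₁} {rail₂} final₁ final₂
                    (segment-edge⇒bases (i≢k ∘ sym) (s≤s z≤n) (s≤s z≤n) q (∈₂ h′) e))

    prism : HasPrism G
    prism = prism-from-rails rail₀ rail₁ rail₂
      (top-~ Si) (subst (λ n → p ~ vertex i n) consecutive (bottom-~ Si)) (vertex-~-suc (<⇒≤ above-base))
      (subst₂ _~_ (sym final₀) (sym final₁) (base-edge j≢k))
      (subst₂ _~_ (sym final₀) (sym final₂) (base-edge (i≢j ∘ sym)))
      (subst₂ _~_ (sym final₁) (sym final₂) (base-edge (i≢k ∘ sym)))
      L₀₁ L₀₂ L₁₂

  reaches-base? : ∀ {m} (S : Span m) → top S < L m ⊎ top S ≡ L m
  reaches-base? S = m≤n⇒m<n∨m≡n (top≤L S)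

  span-shape : ∀ {m} (S : Span m) → bottom S ≡ top S ⊎ bottom S ≡ suc (top S) ⊎ 2 + top S ≤ bottom S
  span-shape S with m≤n⇒m<n∨m≡n (top≤bottom S)
  ... | inj₂ top≡bottom = inj₁ (sym top≡bottom)
  ... | inj₁ top<bottom with m≤n⇒m<n∨m≡n top<bottom
  ...   | inj₂ 1+top≡bottom = inj₂ (inj₁ (sym 1+top≡bottom))
  ...   | inj₁ gap          = inj₂ (inj₂ gap)

  spread⇒top<L : ∀ {m} (S : Span m) → bottom S ≡ suc (top S) ⊎ 2 + top S ≤ bottom S → top S < L m
  spread⇒top<L S (inj₁ consecutive) = ≤-trans (≤-reflexive (sym consecutive)) (bottom≤L S)
  spread⇒top<L S (inj₂ gap)         = ≤-trans (n≤1+n _) (≤-trans gap (bottom≤L S))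

  untouched-∉ : ∀ {m v} → Untouched m → _∈P_ G v (P m) → ¬ p ~ v
  untouched-∉ U v∈ e with ∈⇒vertex v∈
  ... | n , n≤L , refl = U n n≤L e

  AtBaseOnly : Fin 3 → Set
  AtBaseOnly m = ∀ n → n ≤ L m → p ~ vertex m n → n ≡ L m

  untouched⇒at-base-only : ∀ {m} → Untouched m → AtBaseOnly m
  untouched⇒at-base-only U n n≤L e = ⊥-elim (U n n≤L e)

  span-at-base : ∀ {m} (S : Span m) → top S ≡ L m → AtBaseOnly m
  span-at-base S top≡L n n≤L e = ≤-antisym n≤L (subst (_≤ n) top≡L (proj₁ (neighbour-in-span S n≤L e)))

  sole-at-base : ∀ {m} (S : Span m) → top S ≡ L m → bottom S ≡ top S
  sole-at-base S top≡L = ≤-antisym (subst (bottom S ≤_) (sym top≡L) (bottom≤L S)) (top≤bottom S)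

  ~base-at-base : ∀ {m} (S : Span m) → top S ≡ L m → p ~ b m
  ~base-at-base {m} S top≡L = subst (p ~_) (trans (cong (vertex m) top≡L) (vertex-base m)) (top-~ S)

  at-base-only-∈ : ∀ {m v} → AtBaseOnly m → _∈P_ G v (P m) → p ~ v → v ≡ b m
  at-base-only-∈ {m} only v∈ e with ∈⇒vertex v∈
  ... | n , n≤L , refl = trans (cong (vertex m) (only n n≤L e)) (vertex-base m)

  narrow-inside : ∀ {k} (O : Others k) → Untouched (Others.i O) → Untouched (Others.j O) → Narrow G b P p
  narrow-inside {k} O Ui Uj = inj₁ (k , λ v (l , v∈) →
    by-cover {λ l → _∈P_ G v (P l) → p ~ v → _∈P_ G v (P k)}
      (λ v∈ e → ⊥-elim (untouched-∉ Ui v∈ e)) (λ v∈ e → ⊥-elim (untouched-∉ Uj v∈ e)) (λ v∈ _ → v∈) l v∈)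
    where open Others O

  narrow-at-bases : (∀ l → AtBaseOnly l) → Narrow G b P p
  narrow-at-bases only = inj₂ λ v (l , v∈) e → l , at-base-only-∈ (only l) v∈ e

  sole-neighbour-impossible : ∀ {k} (O : Others k) → Untouched k → (Si : Span (Others.i O)) (Sj : Span (Others.j O)) →
                              bottom Sj ≡ top Sj → ¬ HasTheta G → ¬ Wide G b P p
  sole-neighbour-impossible O Uk Si Sj sole ¬θ wide with reaches-base? Si
  ... | inj₁ ti<L = ¬θ (SoleNeighbourTheta.theta i≢j i≢k j≢k Uk Si ti<L Sj sole)
    where open Others O
  ... | inj₂ ti≡L with reaches-base? Sj
  ...   | inj₁ tj<L = ¬θ (SoleNeighbourTheta.theta (i≢j ∘ sym) j≢k i≢k Uk Sj tj<L Si (sole-at-base Si ti≡L))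
    where open Others O
  ...   | inj₂ tj≡L =
    wide (narrow-at-bases (by-cover (span-at-base Si ti≡L) (span-at-base Sj tj≡L) (untouched⇒at-base-only Uk)))
    where open Others O

  jewel-side : ∀ {m} (S : Span m) → bottom S ≡ suc (top S) → bottom S ≡ L m →
               ∀ v → _∈P_ G v (P m) → p ~ v ⇔ (v ≡ b m ⊎ v ~ b m)
  jewel-side {m} S consecutive bottom≡L v v∈ with ∈⇒vertex v∈
  ... | n , n≤L , refl = mk⇔ to from
    where
      1+top≡L : suc (top S) ≡ L m
      1+top≡L = trans (sym consecutive) bottom≡L

      vertex-L : ∀ {n′} → n′ ≡ L m → vertex m n′ ≡ b m
      vertex-L refl = vertex-base m

      to : p ~ vertex m n → vertex m n ≡ b m ⊎ vertex m n ~ b m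
      to e with two-neighbours S consecutive n≤L e
      ... | inj₁ refl = inj₂ (subst (vertex m n ~_) (vertex-L 1+top≡L) (vertex-~-suc (≤-reflexive 1+top≡L)))
      ... | inj₂ refl = inj₁ (vertex-L 1+top≡L)

      from : vertex m n ≡ b m ⊎ vertex m n ~ b m → p ~ vertex m n
      from (inj₁ vn≡b) = subst (λ k → p ~ vertex m k)
                               (trans bottom≡L (vertex-injective ≤-refl n≤L (trans (vertex-base m) (sym vn≡b))))
                               (bottom-~ S)
      from (inj₂ vn~b) with vertex-~⇒consecutive n≤L ≤-refl (subst (vertex m n ~_) (sym (vertex-base m)) vn~b)
      ... | inj₁ 1+n≡L = subst (λ k → p ~ vertex m k) (suc-injective (trans 1+top≡L (sym 1+n≡L))) (top-~ S)
      ... | inj₂ 1+L≡n = ⊥-elim (<-irrefl (sym 1+L≡n) (s≤s n≤L))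

  jewel : ∀ {k} (O : Others k) → Untouched k → (Si : Span (Others.i O)) (Sj : Span (Others.j O)) →
          bottom Si ≡ suc (top Si) → bottom Si ≡ L (Others.i O) →
          bottom Sj ≡ suc (top Sj) → bottom Sj ≡ L (Others.j O) → JewelAt G b P k p
  jewel {k} O Uk Si Sj ci bi cj bj =
    (λ v v∈ → untouched-∉ Uk v∈) ,
    by-cover {λ l → l ≢ k → ∀ v → _∈P_ G v (P l) → p ~ v ⇔ (v ≡ b l ⊎ v ~ b l)}
      (λ _ → jewel-side Si ci bi) (λ _ → jewel-side Sj cj bj) (λ k≢k → ⊥-elim (k≢k refl))
    where open Others O

  two-spans : ∀ {k} (O : Others k) → Untouched k → Span (Others.i O) → Span (Others.j O) →
              ¬ HasTheta G → ¬ HasPrism G → Wide G b P p → JewelAt G b P k p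
  two-spans O Uk Si Sj ¬θ ¬prism wide with span-shape Si | span-shape Sj
  ... | inj₁ sole | _ = ⊥-elim (sole-neighbour-impossible (swapped O) Uk Sj Si sole ¬θ wide)
  ... | inj₂ _ | inj₁ sole = ⊥-elim (sole-neighbour-impossible O Uk Si Sj sole ¬θ wide)
  ... | inj₂ (inj₂ gap) | inj₂ shape =
    ⊥-elim (¬θ (BaseTheta.theta i≢j i≢k j≢k Uk Si gap Sj (spread⇒top<L Sj shape)))
    where open Others O
  ... | inj₂ (inj₁ ci) | inj₂ (inj₂ gap) =
    ⊥-elim (¬θ (BaseTheta.theta (i≢j ∘ sym) j≢k i≢k Uk Sj gap Si (spread⇒top<L Si (inj₁ ci))))
    where open Others O
  ... | inj₂ (inj₁ ci) | inj₂ (inj₁ cj)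
    with m≤n⇒m<n∨m≡n (subst (_≤ _) ci (bottom≤L Si)) | m≤n⇒m<n∨m≡n (subst (_≤ _) cj (bottom≤L Sj))
  ...   | inj₁ below-base | _ = ⊥-elim (¬prism (EdgePrism.prism i≢j i≢k j≢k Uk Si ci below-base Sj))
    where open Others O
  ...   | inj₂ _ | inj₁ below-base = ⊥-elim (¬prism (EdgePrism.prism (i≢j ∘ sym) j≢k i≢k Uk Sj cj below-base Si))
    where open Others O
  ...   | inj₂ i-base | inj₂ j-base = jewel O Uk Si Sj ci (trans ci i-base) cj (trans cj j-base)

  corner-at : ∀ {c} (O : Others c) (S : ∀ m → Span m) → top (S c) < L c →
              top (S (Others.i O)) ≡ L (Others.i O) → top (S (Others.j O)) ≡ L (Others.j O) → CornerVertexAt G b P c p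
  corner-at {c} O S tc<L ti≡L tj≡L =
    (vertex c (top (S c)) , vertex-∈ c _ , top≢base , top-~ (S c)) ,
    by-cover {λ l → l ≢ c → p ~ b l}
      (λ _ → ~base-at-base (S i) ti≡L) (λ _ → ~base-at-base (S j) tj≡L) (λ c≢c → ⊥-elim (c≢c refl)) ,
    λ v (l , v∈) v≢bc e →
      by-cover {λ l → _∈P_ G v (P l) → (_∈P_ G v (P c) × v ≢ b c) ⊎ ∃ λ j → j ≢ c × v ≡ b j}
        (λ v∈ → inj₂ (i , i≢k , at-base-only-∈ (span-at-base (S i) ti≡L) v∈ e))
        (λ v∈ → inj₂ (j , j≢k , at-base-only-∈ (span-at-base (S j) tj≡L) v∈ e))
        (λ v∈ → inj₁ (v∈ , v≢bc)) l v∈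
    where
      open Others O

      top≢base : vertex c (top (S c)) ≢ b c
      top≢base eq = <⇒≢ tc<L (vertex-injective (top≤L (S c)) ≤-refl (trans eq (sym (vertex-base c))))

  three-spans : (S : ∀ m → Span m) → ¬ HasTheta G → Wide G b P p → CornerVertex G b P p
  three-spans S ¬θ wide with pairwise-or-two (λ m → reaches-base? (S m))
  ... | inj₁ short = ⊥-elim (¬θ (theta-from-tops S short))
  ... | inj₂ (c , O , ti≡L , tj≡L) with reaches-base? (S c)
  ...   | inj₁ tc<L = c , corner-at O S tc<L ti≡L tj≡L
  ...   | inj₂ tc≡L = ⊥-elim (wide (narrow-at-bases (by-cover at-base-i at-base-j (span-at-base (S c) tc≡L))))
    where
      open Others O
      at-base-i = span-at-base (S i) ti≡L
      at-base-j = span-at-base (S j) tj≡L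

  wide⇒corner⊎jewel : ¬ HasTheta G → ¬ HasPrism G → Wide G b P p → CornerVertex G b P p ⊎ Jewel G b P p
  wide⇒corner⊎jewel ¬θ ¬prism wide with untouched-or-span 0F | untouched-or-span 1F | untouched-or-span 2F
  ... | inj₁ U₀ | inj₁ U₁ | _       = ⊥-elim (wide (narrow-inside (others 2F) U₀ U₁))
  ... | inj₁ U₀ | inj₂ _  | inj₁ U₂ = ⊥-elim (wide (narrow-inside (others 1F) U₀ U₂))
  ... | inj₂ _  | inj₁ U₁ | inj₁ U₂ = ⊥-elim (wide (narrow-inside (others 0F) U₁ U₂))
  ... | inj₁ U₀ | inj₂ S₁ | inj₂ S₂ = inj₂ (0F , two-spans (others 0F) U₀ S₁ S₂ ¬θ ¬prism wide)
  ... | inj₂ S₀ | inj₁ U₁ | inj₂ S₂ = inj₂ (1F , two-spans (others 1F) U₁ S₀ S₂ ¬θ ¬prism wide)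
  ... | inj₂ S₀ | inj₂ S₁ | inj₁ U₂ = inj₂ (2F , two-spans (others 2F) U₂ S₀ S₁ ¬θ ¬prism wide)
  ... | inj₂ S₀ | inj₂ S₁ | inj₂ S₂ = inj₁ (three-spans (λ { 0F → S₀ ; 1F → S₁ ; 2F → S₂ }) ¬θ wide)

  two-bases-not-local : ∀ {k} (O : Others k) → p ~ b (Others.i O) → p ~ b (Others.j O) →
                        ¬ ∃ λ m → ∀ v → _∈Σ_ G b P v → p ~ v → _∈P_ G v (P m)
  two-bases-not-local O p~bi p~bj (m , local) =
    i≢j (trans (base-∈⇒≡ (local _ (i , base-∈ i) p~bi)) (sym (base-∈⇒≡ (local _ (j , base-∈ j) p~bj))))
    where open Others O

  corner⇒wide : CornerVertex G b P p → Wide G b P p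
  corner⇒wide (c , _ , p~b , _) (inj₁ local) = two-bases-not-local (others c) (p~b _ i≢k) (p~b _ j≢k) local
    where open Others (others c)
  corner⇒wide (c , (v , v∈ , v≢bc , e) , _ , _) (inj₂ bases) with bases v (c , v∈) e
  ... | l , refl = v≢bc (cong b (base-∈⇒≡ v∈))

  jewel⇒wide : Jewel G b P p → Wide G b P p
  jewel⇒wide (k , _ , sides) (inj₁ local) =
    two-bases-not-local (others k) (Equivalence.from (sides i i≢k (b i) (base-∈ i)) (inj₁ refl))
                                   (Equivalence.from (sides j j≢k (b j) (base-∈ j)) (inj₁ refl)) local
    where open Others (others k)
  jewel⇒wide (k , _ , sides) (inj₂ bases) =
    let v , v∈ , v~b , not-base = neighbour-of-base i
        l , v≡bl                = bases v (i , v∈) (Equivalence.from (sides i i≢k v v∈) (inj₂ v~b))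
    in not-base l v≡bl
    where open Others (others k)

  wide⇔corner⊎jewel : ¬ HasTheta G → ¬ HasPrism G → Wide G b P p ⇔ (CornerVertex G b P p ⊎ Jewel G b P p)
  wide⇔corner⊎jewel ¬θ ¬prism = mk⇔ (wide⇒corner⊎jewel ¬θ ¬prism) [ corner⇒wide , jewel⇒wide ]

lemma3p1 : (G : Graph) → ¬ HasTheta G → ¬ HasPrism G →
           (H : Subset (Graph.n G)) (a : V G) → a ∈ H → Trapped G H a →
           (b : Fin 3 → V G) (P : Fin 3 → Path G) → IsPyramid G a b P →
           (∀ i v → _∈P_ G v (P i) → v ∈ H) →
           (p : V G) → p ∉ H →
           (Wide G b P p ⇔ (CornerVertex G b P p ⊎ Jewel G b P p))
lemma3p1 G ¬θ ¬prism H a _ (near-a∈H , _) b P pyramid Σ⊆H p p∉H =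
  Attachments.wide⇔corner⊎jewel G {a} {b} {P} pyramid p p∉Σ p≁a p≁N[a] ¬θ ¬prism
  where
    open InducedLists G using (~-sym)

    p∉Σ : ∀ m v → _∈P_ G v (P m) → v ≢ p
    p∉Σ m v v∈ refl = p∉H (Σ⊆H m v v∈)

    p≁a : ¬ Edge G p a
    p≁a e = p∉H (near-a∈H p (inj₂ (inj₁ (~-sym e))))

    p≁N[a] : ∀ v → Edge G a v → ¬ Edge G p v
    p≁N[a] v a~v e = p∉H (near-a∈H p (inj₂ (inj₂ (v , a~v , ~-sym e))))
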